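{- Let $m\ge 7$, $X=\mathbb{F}_{2^m}\setminus\{0,1\}$, and let $W_7$ be as in the context. Then every element $x\in X$ lies in exactly $r_7=\frac{(2^m-4)(2^m-8)(2^m-16)(2^m-32)(2^m-64)}{6!}$ blocks of $W_7$ (the repetition number of $(X,W_2,W_7)$), and $|W_7|=\frac{(2^m-2)(2^m-4)(2^m-8)(2^m-16)(2^m-32)(2^m-64)}{7!}$.
   Context: $\mathbb{F}_{2^m}$ is the finite field with $2^m$ elements, with zero $0$ and unity $1$; all sums are in $\mathbb{F}_{2^m}$. For each integer $k\ge 2$, $W_k=\{B\subset X : |B|=k,\ \sum_{i\in B} i=1,\ \text{and } \binom{B}{\ell}\cap W_\ell=\emptyset \text{ for all } 2\le \ell\le k-3\}$ (recursive definition; $\binom{B}{\ell}$ is the set of $\ell$-subsets of $B$). -}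

module Defs where

open import Data.Nat using (ℕ; zero; suc; _≤ᵇ_)
import Data.Bool
open import Data.Bool using (Bool; true; false; _∧_; _∨_; not; if_then_else_)
open import Data.Fin using (Fin)
open import Data.Fin.Subset using (Subset)
open import Data.Vec using (Vec; []; _∷_; lookup)
open import Data.List using (List; []; _∷_; _++_; map; foldr; allFin; filter; length)
import Data.List as List
open import Relation.Nullary.Decidable using (⌊_⌋; does)
open import Relation.Binary.PropositionalEquality using (_≡_; _≢_)
open import Data.Product using (∃)
open import Algebra.Structures using (IsCommutativeRing)
import Data.Fin as Fin
import Data.Nat as Nat

-- A field structure whose carrier is Fin q (q elements), with propositional
-- equality.  Every finite field of order q is isomorphic to such a structure.
record FieldOn (q : ℕ) : Set where
  field
    _+_ _*_ : Fin q → Fin q → Fin q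
    -_ : Fin q → Fin q
    0# 1# : Fin q
    isCommutativeRing : IsCommutativeRing _≡_ _+_ _*_ -_ 0# 1#
    0≢1 : 0# ≢ 1#
    inverse : ∀ x → x ≢ 0# → ∃ λ y → x * y ≡ 1#

allᵇ : ∀ {A : Set} → (A → Bool) → List A → Bool
allᵇ p [] = true
allᵇ p (x ∷ xs) = p x ∧ allᵇ p xs

allSubsets : (n : ℕ) → List (Subset n)
allSubsets zero = [] ∷ []
allSubsets (suc n) = map (true ∷_) (allSubsets n) ++ map (false ∷_) (allSubsets n)

card : ∀ {n} → Subset n → ℕ
card [] = 0
card (true ∷ s) = suc (card s)
card (false ∷ s) = card s

subsetᵇ : ∀ {n} → Subset n → Subset n → Bool
subsetᵇ [] [] = true
subsetᵇ (c ∷ C) (b ∷ B) = (not c ∨ b) ∧ subsetᵇ C B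

module Blocks {q : ℕ} (F : FieldOn q) where
  open FieldOn F

  eqᵇ : Fin q → Fin q → Bool
  eqᵇ x y = ⌊ x Fin.≟ y ⌋

  inXᵇ : Fin q → Bool
  inXᵇ x = not (eqᵇ x 0#) ∧ not (eqᵇ x 1#)

  subXᵇ : Subset q → Bool
  subXᵇ B = allᵇ (λ i → not (lookup B i) ∨ inXᵇ i) (allFin q)

  sumSub : Subset q → Fin q
  sumSub B = foldr (λ i acc → if lookup B i then i + acc else acc) 0# (allFin q)

  -- W with fuel; W k := Wf k k.  The recursive calls are at ℓ ≤ k - 3,
  -- so fuel k always suffices (fuel strictly exceeds every index requested
  -- below the top level).
  Wf : ℕ → ℕ → Subset q → Bool
  Wf zero k B = false
  Wf (suc f) k B =
    subXᵇ B ∧ ⌊ card B Nat.≟ k ⌋ ∧ eqᵇ (sumSub B) 1# ∧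
    allᵇ (λ ℓ → not ((2 ≤ᵇ ℓ) ∧ ((ℓ Nat.+ 3) ≤ᵇ k)) ∨
      allᵇ (λ C → not (subsetᵇ C B ∧ ⌊ card C Nat.≟ ℓ ⌋) ∨ not (Wf f ℓ C))
               (allSubsets q))
      (List.upTo k)

  W : ℕ → Subset q → Bool
  W k B = Wf k k B

  sizeW : ℕ → ℕ
  sizeW k = length (filter (λ B → W k B Data.Bool.≟ true) (allSubsets q))

  repW : ℕ → Fin q → ℕ
  repW k x = length (filter (λ B → (W k B ∧ lookup B x) Data.Bool.≟ true) (allSubsets q))

module Submission where

-- Call B ⊆ F independent when no nonempty C ⊆ B has ∑ C ∈ {0, 1}, i.e. B ∪ {1}
-- is linearly independent over 𝔽₂.  The proof has three steps.
-- (1) B ∪ {1} spans 2^(|B|+1) elements, and B ∪ {y} is independent exactly when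
--     y lies outside this span.  Double counting pairs (B, y) gives, for the
--     number N_A(k) of independent k-sets containing A,
--         N_A(k+1) · (k+1 − |A|) = N_A(k) · (q − 2^(k+1)).
-- (2) For y ∉ D: D ∪ {y} ∈ W₇ iff |D| = 6, D is independent and y = ∑ D + 1.
--     (A subset of a block and its complement in the block have sums in {0, 1}
--     simultaneously, which reduces everything to the forbidden sizes 2, 3, 4.)
--     Double counting again gives (7 − |A|) · #{B ∈ W₇ : A ⊆ B} = N_A(6).
-- (3) For A = ∅ and A = {x} the recursion telescopes to the two formulas.  F has
--     characteristic 2 because it has an even number of elements.

open import Defs
import Data.Nat as Nat
import Data.List
import Data.Vec
open import Data.Nat using (ℕ; zero; suc; _+_; _*_; _∸_; _^_; _!; _≤_; z≤n; s≤s; _≡ᵇ_; _<ᵇ_)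
open import Data.Nat.Properties
  using (module ≤-Reasoning; +-identityʳ; +-suc; +-comm; *-comm; *-assoc; *-zeroʳ; *-identityˡ; *-identityʳ;
         *-distribˡ-+; ≤-refl; ≤-trans; ≤-reflexive; m≤m+n; m≤n+m; m≤n⇒m≤1+n; m+n∸n≡m; m+n∸m≡n;
         m∸n+n≡m; m≤n⇒m∸n≡0; n≤0⇒n≡0; 1+n≰n; <⇒≢; +-cancelʳ-≡; ≤-pred; suc-injective; ≡ᵇ⇒≡; ≡⇒≡ᵇ; even≢odd; +-*-semiring)
open import Data.Bool using (Bool; true; false; _∧_; _∨_; not; _xor_; if_then_else_)
import Data.Bool as Bool
open import Data.Bool.Properties using (∧-zeroʳ; ∧-identityʳ; ∧-assoc; ∧-comm; ∨-zeroʳ; T-≡; ⇔→≡)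
open import Function.Bundles using (Equivalence; mk⇔)
open import Data.Fin using (Fin; zero; suc; toℕ)
import Data.Fin as Fin
open import Data.Fin.Subset using (Subset; ⁅_⁆) renaming (⊥ to ∅)
open import Data.Vec using ([]; _∷_; lookup; _[_]≔_; zipWith)
open import Data.Vec.Properties using (tabulate∘lookup; lookup∘update; lookup∘update′; []≔-idempotent; []≔-lookup; ∷-injectiveʳ)
open import Data.List using (List; []; _∷_; _++_; map; filter; length; allFin)
open import Data.List.Properties using (map-++; map-∘)
import Data.Nat.ListAction as List
open import Data.Nat.ListAction.Properties using (sum-++)
open import Data.List.Membership.Propositional using (_∈_)
open import Data.List.Membership.Propositional.Properties using (∈-map⁺; ∈-++⁺ˡ; ∈-++⁺ʳ; ∈-allFin)
open import Data.List.Relation.Unary.Any using (here; there)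
open import Data.Product using (∃; _×_; _,_; proj₁; proj₂)
open import Data.Sum using (_⊎_; inj₁; inj₂)
open import Data.Empty using (⊥; ⊥-elim)
open import Relation.Nullary using (Dec; yes; no; ¬_)
open import Relation.Nullary.Decidable using (⌊_⌋)
open import Relation.Binary.PropositionalEquality
open import Function using (_∘_; id)
open import Level using (0ℓ)
open import Algebra.Bundles using (CommutativeRing; CommutativeMonoid)
import Algebra.Properties.CommutativeSemigroup as CommutativeSemigroupProperties
import Algebra.Properties.Ring as RingProperties
open import Data.Fin.Permutation using (permutation)
open import Algebra.Properties.Semiring.Sum +-*-semiring
  using (sum; sum-cong-≗; ∑-distrib-+; *-distribˡ-sum; sum-replicate-zero; sum-permute)

⟦_⟧ : Bool → ℕ
⟦ true ⟧ = 1
⟦ false ⟧ = 0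

⟦∧⟧ : ∀ a b → ⟦ a ∧ b ⟧ ≡ ⟦ a ⟧ * ⟦ b ⟧
⟦∧⟧ true b = sym (+-identityʳ ⟦ b ⟧)
⟦∧⟧ false b = refl

∧-true : ∀ {a b} → a ∧ b ≡ true → a ≡ true × b ≡ true
∧-true {true} {true} _ = refl , refl

∧-intro : ∀ {a b} → a ≡ true → b ≡ true → a ∧ b ≡ true
∧-intro refl refl = refl

≡ᵇ-sound : ∀ m n → (m ≡ᵇ n) ≡ true → m ≡ n
≡ᵇ-sound m n e = ≡ᵇ⇒≡ m n (subst Bool.T (sym e) _)

≡ᵇ-complete : ∀ {m n} → m ≡ n → (m ≡ᵇ n) ≡ true
≡ᵇ-complete {m} refl = Equivalence.to T-≡ (≡⇒≡ᵇ m m refl)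

⌊⌋-true : ∀ {P : Set} (d : Dec P) → ⌊ d ⌋ ≡ true → P
⌊⌋-true (yes p) _ = p

⌊⌋-yes : ∀ {P : Set} (d : Dec P) → P → ⌊ d ⌋ ≡ true
⌊⌋-yes (yes _) _ = refl
⌊⌋-yes (no ¬p) p = ⊥-elim (¬p p)

⌊⌋-no : ∀ {P : Set} (d : Dec P) → ¬ P → ⌊ d ⌋ ≡ false
⌊⌋-no (yes p) ¬p = ⊥-elim (¬p p)
⌊⌋-no (no _) _ = refl

⌊⌋-⇔ : ∀ {P Q : Set} (d : Dec P) (e : Dec Q) → (P → Q) → (Q → P) → ⌊ d ⌋ ≡ ⌊ e ⌋
⌊⌋-⇔ (yes p) e to from = sym (⌊⌋-yes e (to p))
⌊⌋-⇔ (no ¬p) e to from = sym (⌊⌋-no e (¬p ∘ from))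

sum-ones : ∀ n → sum {n} (λ _ → 1) ≡ n
sum-ones zero = refl
sum-ones (suc n) = cong suc (sum-ones n)

⌊≟⌋-suc : ∀ {n} (x y : Fin n) → ⌊ suc x Fin.≟ suc y ⌋ ≡ ⌊ x Fin.≟ y ⌋
⌊≟⌋-suc x y with x Fin.≟ y
... | yes _ = refl
... | no _ = refl

sum-≟ : ∀ {n} (a : Fin n) → sum (λ y → ⟦ ⌊ a Fin.≟ y ⌋ ⟧) ≡ 1
sum-≟ {suc n} zero = cong suc (sum-replicate-zero n)
sum-≟ {suc n} (suc a) = trans (sum-cong-≗ (cong ⟦_⟧ ∘ ⌊≟⌋-suc a)) (sum-≟ a)

sum-complement : ∀ {n} (h : Fin n → ℕ) → (∀ y → h y ≤ 1) → sum (λ y → 1 ∸ h y) ≡ n ∸ sum h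
sum-complement {n} h h≤1 = begin
  sum (λ y → 1 ∸ h y)                   ≡⟨ m+n∸n≡m _ (sum h) ⟨
  sum (λ y → 1 ∸ h y) + sum h ∸ sum h   ≡⟨ cong (_∸ sum h) (∑-distrib-+ (λ y → 1 ∸ h y) h) ⟨
  sum (λ y → 1 ∸ h y + h y) ∸ sum h     ≡⟨ cong (_∸ sum h) (sum-cong-≗ (λ y → m∸n+n≡m (h≤1 y))) ⟩
  sum {n} (λ _ → 1) ∸ sum h             ≡⟨ cong (_∸ sum h) (sum-ones n) ⟩
  n ∸ sum h                             ∎
  where open ≡-Reasoning

product : ℕ → (ℕ → ℕ) → ℕ
product zero t = 1
product (suc zero) t = t 0
product (suc (suc j)) t = product (suc j) t * t (suc j)

product-suc : ∀ j t → product (suc j) t ≡ product j t * t j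
product-suc zero t = sym (+-identityʳ (t 0))
product-suc (suc j) t = refl

telescope : ∀ (N t : ℕ → ℕ) a → (∀ j → N (suc (a + j)) * suc j ≡ N (a + j) * t (a + j)) →
  ∀ j → N (a + j) * j ! ≡ N a * product j (λ i → t (a + i))
telescope N t a step zero = cong (λ k → N k * 1) (+-identityʳ a)
telescope N t a step (suc j) = begin
  N (a + suc j) * (suc j * j !)   ≡⟨ cong (λ k → N k * (suc j * j !)) (+-suc a j) ⟩
  N (suc (a + j)) * (suc j * j !) ≡⟨ *-assoc (N (suc (a + j))) (suc j) (j !) ⟨
  N (suc (a + j)) * suc j * j !   ≡⟨ cong (_* j !) (step j) ⟩
  N (a + j) * t (a + j) * j !     ≡⟨ *-assoc (N (a + j)) (t (a + j)) (j !) ⟩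
  N (a + j) * (t (a + j) * j !)   ≡⟨ cong (N (a + j) *_) (*-comm (t (a + j)) (j !)) ⟩
  N (a + j) * (j ! * t (a + j))   ≡⟨ *-assoc (N (a + j)) (j !) (t (a + j)) ⟨
  N (a + j) * j ! * t (a + j)     ≡⟨ cong (_* t (a + j)) (telescope N t a step j) ⟩
  N a * product j (λ i → t (a + i)) * t (a + j) ≡⟨ *-assoc (N a) _ (t (a + j)) ⟩
  N a * (product j (λ i → t (a + i)) * t (a + j)) ≡⟨ cong (N a *_) (product-suc j (λ i → t (a + i))) ⟨
  N a * product (suc j) (λ i → t (a + i)) ∎
  where open ≡-Reasoning

_<ᶠ_ : ∀ {n} → Fin n → Fin n → Bool
a <ᶠ b = toℕ a <ᵇ toℕ b

<ᶠ-trichotomy : ∀ {n} (a b : Fin n) → ⟦ a <ᶠ b ⟧ + ⟦ b <ᶠ a ⟧ + ⟦ ⌊ a Fin.≟ b ⌋ ⟧ ≡ 1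
<ᶠ-trichotomy zero zero = refl
<ᶠ-trichotomy zero (suc b) = refl
<ᶠ-trichotomy (suc a) zero = refl
<ᶠ-trichotomy (suc a) (suc b) = trans (cong (⟦ a <ᶠ b ⟧ + ⟦ b <ᶠ a ⟧ +_) (cong ⟦_⟧ (⌊≟⌋-suc a b))) (<ᶠ-trichotomy a b)

-- An involution σ of Fin n swaps the points with y < σ y and those with σ y < y,
-- so n is the number of fixed points plus an even number.
involution-parity : ∀ {n} (σ : Fin n → Fin n) → (∀ y → σ (σ y) ≡ y) →
  ∃ λ k → n ≡ sum (λ y → ⟦ ⌊ y Fin.≟ σ y ⌋ ⟧) + 2 * k
involution-parity {n} σ σσ = A , (begin
  n                                                 ≡⟨ sum-ones n ⟨
  sum {n} (λ _ → 1)                                 ≡⟨ sum-cong-≗ (λ y → <ᶠ-trichotomy y (σ y)) ⟨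
  sum (λ y → ⟦ y <ᶠ σ y ⟧ + ⟦ σ y <ᶠ y ⟧ + fixed y)  ≡⟨ ∑-distrib-+ (λ y → ⟦ y <ᶠ σ y ⟧ + ⟦ σ y <ᶠ y ⟧) fixed ⟩
  sum (λ y → ⟦ y <ᶠ σ y ⟧ + ⟦ σ y <ᶠ y ⟧) + Fix     ≡⟨ cong (_+ Fix) (∑-distrib-+ (λ y → ⟦ y <ᶠ σ y ⟧) (λ y → ⟦ σ y <ᶠ y ⟧)) ⟩
  A + sum (λ y → ⟦ σ y <ᶠ y ⟧) + Fix                ≡⟨ cong (λ r → A + r + Fix) swapped ⟩
  A + A + Fix                                       ≡⟨ +-comm (A + A) Fix ⟩
  Fix + (A + A)                                     ≡⟨ cong (λ r → Fix + (A + r)) (+-identityʳ A) ⟨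
  Fix + 2 * A                                       ∎)
  where
  open ≡-Reasoning
  fixed : Fin n → ℕ
  fixed y = ⟦ ⌊ y Fin.≟ σ y ⌋ ⟧
  Fix A : ℕ
  Fix = sum fixed
  A = sum (λ y → ⟦ y <ᶠ σ y ⟧)
  -- reindexing by σ turns `σ y < y` into `y < σ y`
  swapped : sum (λ y → ⟦ σ y <ᶠ y ⟧) ≡ A
  swapped = trans (sum-permute (λ y → ⟦ σ y <ᶠ y ⟧) (permutation σ σ σσ σσ))
                  (sum-cong-≗ (λ y → cong (λ z → ⟦ z <ᶠ σ y ⟧) (σσ y)))

sumˢ : ∀ {n} → (Subset n → ℕ) → ℕ
sumˢ {zero} f = f []
sumˢ {suc n} f = sumˢ (f ∘ (true ∷_)) + sumˢ (f ∘ (false ∷_))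

sumˢ-cong : ∀ {n} {f g : Subset n → ℕ} → (∀ B → f B ≡ g B) → sumˢ f ≡ sumˢ g
sumˢ-cong {zero} e = e []
sumˢ-cong {suc n} e = cong₂ _+_ (sumˢ-cong (e ∘ (true ∷_))) (sumˢ-cong (e ∘ (false ∷_)))

sumˢ-zero : ∀ n → sumˢ {n} (λ _ → 0) ≡ 0
sumˢ-zero zero = refl
sumˢ-zero (suc n) = cong₂ _+_ (sumˢ-zero n) (sumˢ-zero n)

sumˢ-distribˡ : ∀ {n} c (f : Subset n → ℕ) → sumˢ (λ B → c * f B) ≡ c * sumˢ f
sumˢ-distribˡ {zero} c f = refl
sumˢ-distribˡ {suc n} c f =
  trans (cong₂ _+_ (sumˢ-distribˡ c (f ∘ (true ∷_))) (sumˢ-distribˡ c (f ∘ (false ∷_))))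
    (sym (*-distribˡ-+ c _ _))

sumˢ-distribʳ : ∀ {n} (f : Subset n → ℕ) c → sumˢ (λ B → f B * c) ≡ sumˢ f * c
sumˢ-distribʳ f c = trans (sumˢ-cong (λ B → *-comm (f B) c)) (trans (sumˢ-distribˡ c f) (*-comm c (sumˢ f)))

sumˢ-comm : ∀ {n m} (g : Subset n → Fin m → ℕ) →
  sumˢ (λ B → sum (g B)) ≡ sum (λ y → sumˢ (λ B → g B y))
sumˢ-comm {zero} g = refl
sumˢ-comm {suc n} g = begin
  sumˢ (λ B → sum (g (true ∷ B))) + sumˢ (λ B → sum (g (false ∷ B)))
    ≡⟨ cong₂ _+_ (sumˢ-comm (g ∘ (true ∷_))) (sumˢ-comm (g ∘ (false ∷_))) ⟩
  sum (λ y → sumˢ (λ B → g (true ∷ B) y)) + sum (λ y → sumˢ (λ B → g (false ∷ B) y))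
    ≡⟨ ∑-distrib-+ (λ y → sumˢ (λ B → g (true ∷ B) y)) (λ y → sumˢ (λ B → g (false ∷ B) y)) ⟨
  sum (λ y → sumˢ (λ B → g B y)) ∎
  where open ≡-Reasoning

term≤sumˢ : ∀ {n} (f : Subset n → ℕ) C → f C ≤ sumˢ f
term≤sumˢ f [] = ≤-refl
term≤sumˢ f (true ∷ C) = ≤-trans (term≤sumˢ (f ∘ (true ∷_)) C) (m≤m+n _ _)
term≤sumˢ f (false ∷ C) = ≤-trans (term≤sumˢ (f ∘ (false ∷_)) C) (m≤n+m _ _)

sumˢ-witness : ∀ {n} (f : Subset n → ℕ) → 1 ≤ sumˢ f → ∃ λ B → 1 ≤ f B
sumˢ-witness {zero} f p = [] , p
sumˢ-witness {suc n} f p with sumˢ (f ∘ (true ∷_)) in e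
... | suc _ = let (B , q) = sumˢ-witness (f ∘ (true ∷_)) (subst (1 ≤_) (sym e) (s≤s z≤n)) in true ∷ B , q
... | zero = let (B , q) = sumˢ-witness (f ∘ (false ∷_)) p in false ∷ B , q

sumˢ-atMostOne : ∀ {n} (f : Subset n → ℕ) → (∀ B → f B ≤ 1) →
  (∀ B C → 1 ≤ f B → 1 ≤ f C → B ≡ C) → sumˢ f ≤ 1
sumˢ-atMostOne {zero} f f≤1 unique = f≤1 []
sumˢ-atMostOne {suc n} f f≤1 unique with sumˢ (f ∘ (true ∷_)) in e
... | zero = sumˢ-atMostOne (f ∘ (false ∷_)) (f≤1 ∘ (false ∷_)) (λ B C p q → ∷-injectiveʳ (unique _ _ p q))
... | suc k = begin
  suc k + sumˢ (f ∘ (false ∷_)) ≡⟨ cong (suc k +_) (trans (sumˢ-cong rest) (sumˢ-zero n)) ⟩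
  suc k + 0                     ≡⟨ +-identityʳ (suc k) ⟩
  suc k                         ≡⟨ e ⟨
  sumˢ (f ∘ (true ∷_))          ≤⟨ sumˢ-atMostOne (f ∘ (true ∷_)) (f≤1 ∘ (true ∷_)) (λ B C p q → ∷-injectiveʳ (unique _ _ p q)) ⟩
  1                             ∎
  where
  open ≤-Reasoning
  witness : ∃ λ B → 1 ≤ f (true ∷ B)
  witness = sumˢ-witness (f ∘ (true ∷_)) (subst (1 ≤_) (sym e) (s≤s z≤n))
  -- a positive term in the second half would be a second positive term
  rest : ∀ C → f (false ∷ C) ≡ 0
  rest C with f (false ∷ C) in fC | witness
  ... | zero | _ = refl
  ... | suc _ | B , pB with unique (true ∷ B) (false ∷ C) pB (subst (1 ≤_) (sym fC) (s≤s z≤n))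
  ...   | ()

-- Inserting y is a bijection from the subsets missing y onto those containing y.
sumˢ-insert : ∀ {n} (y : Fin n) (p : Subset n → Bool) →
  sumˢ (λ B → ⟦ lookup B y ∧ p B ⟧) ≡ sumˢ (λ B → ⟦ not (lookup B y) ∧ p (B [ y ]≔ true) ⟧)
sumˢ-insert {suc n} zero p = +-comm (sumˢ (λ B → ⟦ p (true ∷ B) ⟧)) (sumˢ {n} (λ _ → 0))
sumˢ-insert {suc n} (suc y) p = cong₂ _+_ (sumˢ-insert y (p ∘ (true ∷_))) (sumˢ-insert y (p ∘ (false ∷_)))

⊆-refl : ∀ {n} (B : Subset n) → subsetᵇ B B ≡ true
⊆-refl [] = refl
⊆-refl (true ∷ B) = ⊆-refl B
⊆-refl (false ∷ B) = ⊆-refl B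

∅-⊆ : ∀ {n} (B : Subset n) → subsetᵇ ∅ B ≡ true
∅-⊆ [] = refl
∅-⊆ (b ∷ B) = ∅-⊆ B

⁅⁆-⊆ : ∀ {n} (B : Subset n) x → subsetᵇ ⁅ x ⁆ B ≡ lookup B x
⁅⁆-⊆ (true ∷ B) zero = ∅-⊆ B
⁅⁆-⊆ (false ∷ B) zero = refl
⁅⁆-⊆ (b ∷ B) (suc x) = ⁅⁆-⊆ B x

⊆-∈ : ∀ {n} (C B : Subset n) y → subsetᵇ C B ≡ true → lookup C y ≡ true → lookup B y ≡ true
⊆-∈ (true ∷ C) (true ∷ B) zero _ _ = refl
⊆-∈ (c ∷ C) (b ∷ B) (suc y) C⊆B = ⊆-∈ C B y (proj₂ (∧-true {not c ∨ b} C⊆B))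

⊆-∉ : ∀ {n} (C B : Subset n) y → subsetᵇ C B ≡ true → lookup B y ≡ false → lookup C y ≡ false
⊆-∉ C B y C⊆B y∉B with lookup C y in yC
... | false = refl
... | true = trans (sym (⊆-∈ C B y C⊆B yC)) y∉B

⊆-insert : ∀ {n} (C B : Subset n) y → subsetᵇ C B ≡ true → subsetᵇ C (B [ y ]≔ true) ≡ true
⊆-insert (true ∷ C) (b ∷ B) zero C⊆B = proj₂ (∧-true {b} C⊆B)
⊆-insert (false ∷ C) (b ∷ B) zero C⊆B = C⊆B
⊆-insert (true ∷ C) (true ∷ B) (suc y) C⊆B = ⊆-insert C B y C⊆B
⊆-insert (false ∷ C) (b ∷ B) (suc y) C⊆B = ⊆-insert C B y C⊆B

⊆-insert₂ : ∀ {n} (C B : Subset n) y → subsetᵇ C B ≡ true → subsetᵇ (C [ y ]≔ true) (B [ y ]≔ true) ≡ true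
⊆-insert₂ (true ∷ C) (true ∷ B) zero C⊆B = C⊆B
⊆-insert₂ (false ∷ C) (b ∷ B) zero C⊆B = C⊆B
⊆-insert₂ (true ∷ C) (true ∷ B) (suc y) C⊆B = ⊆-insert₂ C B y C⊆B
⊆-insert₂ (false ∷ C) (b ∷ B) (suc y) C⊆B = ⊆-insert₂ C B y C⊆B

⊆-insert-∉ : ∀ {n} (A B : Subset n) y → lookup A y ≡ false → subsetᵇ A (B [ y ]≔ true) ≡ subsetᵇ A B
⊆-insert-∉ (false ∷ A) (b ∷ B) zero _ = refl
⊆-insert-∉ (true ∷ A) (true ∷ B) (suc y) y∉A = ⊆-insert-∉ A B y y∉A
⊆-insert-∉ (true ∷ A) (false ∷ B) (suc y) y∉A = refl
⊆-insert-∉ (false ∷ A) (b ∷ B) (suc y) y∉A = ⊆-insert-∉ A B y y∉A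

⊆-remove : ∀ {n} (C B : Subset n) y → subsetᵇ C (B [ y ]≔ true) ≡ true → subsetᵇ (C [ y ]≔ false) B ≡ true
⊆-remove (c ∷ C) (b ∷ B) zero C⊆B+y = proj₂ (∧-true {not c ∨ true} C⊆B+y)
⊆-remove (true ∷ C) (true ∷ B) (suc y) C⊆B+y = ⊆-remove C B y C⊆B+y
⊆-remove (false ∷ C) (b ∷ B) (suc y) C⊆B+y = ⊆-remove C B y C⊆B+y

remove-insert : ∀ {n} (C : Subset n) y → lookup C y ≡ true → (C [ y ]≔ false) [ y ]≔ true ≡ C
remove-insert C y y∈C = trans ([]≔-idempotent C y) (trans (cong (C [ y ]≔_) (sym y∈C)) ([]≔-lookup C y))

lookup-∅ : ∀ {n} (i : Fin n) → lookup ∅ i ≡ false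
lookup-∅ zero = refl
lookup-∅ (suc i) = lookup-∅ i

⁅⁆-member : ∀ {n} (x i : Fin n) → lookup ⁅ x ⁆ i ≡ true → i ≡ x
⁅⁆-member zero zero _ = refl
⁅⁆-member zero (suc i) i∈x with trans (sym (lookup-∅ i)) i∈x
... | ()
⁅⁆-member (suc x) (suc i) i∈x = cong suc (⁅⁆-member x i i∈x)

card-∅ : ∀ n → card {n} ∅ ≡ 0
card-∅ zero = refl
card-∅ (suc n) = card-∅ n

card-⁅⁆ : ∀ {n} (x : Fin n) → card ⁅ x ⁆ ≡ 1
card-⁅⁆ {suc n} zero = cong suc (card-∅ n)
card-⁅⁆ (suc x) = card-⁅⁆ x

card-insert : ∀ {n} (B : Subset n) y → lookup B y ≡ false → card (B [ y ]≔ true) ≡ suc (card B)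
card-insert (false ∷ B) zero _ = refl
card-insert (true ∷ B) (suc y) y∉B = cong suc (card-insert B y y∉B)
card-insert (false ∷ B) (suc y) y∉B = card-insert B y y∉B

card-remove : ∀ {n} (C : Subset n) y → lookup C y ≡ true → card C ≡ suc (card (C [ y ]≔ false))
card-remove C y y∈C = trans (cong card (sym (remove-insert C y y∈C)))
  (card-insert (C [ y ]≔ false) y (lookup∘update y C false))

card-mono : ∀ {n} (C B : Subset n) → subsetᵇ C B ≡ true → card C ≤ card B
card-mono [] [] _ = z≤n
card-mono (true ∷ C) (true ∷ B) C⊆B = s≤s (card-mono C B C⊆B)
card-mono (false ∷ C) (true ∷ B) C⊆B = m≤n⇒m≤1+n (card-mono C B C⊆B)
card-mono (false ∷ C) (false ∷ B) C⊆B = card-mono C B C⊆B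

card-witness : ∀ {n} (C : Subset n) → 1 ≤ card C → ∃ λ y → lookup C y ≡ true
card-witness (true ∷ C) _ = zero , refl
card-witness (false ∷ C) p = let (y , y∈C) = card-witness C p in suc y , y∈C

card-difference : ∀ {n} (A B : Subset n) → subsetᵇ A B ≡ true →
  sum (λ y → ⟦ lookup B y ∧ not (lookup A y) ⟧) + card A ≡ card B
card-difference [] [] _ = refl
card-difference (true ∷ A) (true ∷ B) A⊆B = trans (+-suc _ _) (cong suc (card-difference A B A⊆B))
card-difference (false ∷ A) (true ∷ B) A⊆B = cong suc (card-difference A B A⊆B)
card-difference (false ∷ A) (false ∷ B) A⊆B = card-difference A B A⊆B

_△_ : ∀ {n} → Subset n → Subset n → Subset n
_△_ = zipWith _xor_

△-⊆ : ∀ {n} (C D B : Subset n) → subsetᵇ C B ≡ true → subsetᵇ D B ≡ true → subsetᵇ (C △ D) B ≡ true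
△-⊆ [] [] [] _ _ = refl
△-⊆ (true ∷ C) (true ∷ D) (true ∷ B) C⊆B D⊆B = △-⊆ C D B C⊆B D⊆B
△-⊆ (true ∷ C) (false ∷ D) (true ∷ B) C⊆B D⊆B = △-⊆ C D B C⊆B D⊆B
△-⊆ (false ∷ C) (true ∷ D) (true ∷ B) C⊆B D⊆B = △-⊆ C D B C⊆B D⊆B
△-⊆ (false ∷ C) (false ∷ D) (b ∷ B) C⊆B D⊆B = △-⊆ C D B C⊆B D⊆B

△-empty : ∀ {n} (C D : Subset n) → card (C △ D) ≡ 0 → C ≡ D
△-empty [] [] _ = refl
△-empty (true ∷ C) (true ∷ D) e = cong (true ∷_) (△-empty C D e)
△-empty (false ∷ C) (false ∷ D) e = cong (false ∷_) (△-empty C D e)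

card-△ : ∀ {n} (B C : Subset n) → subsetᵇ C B ≡ true → card (B △ C) + card C ≡ card B
card-△ [] [] _ = refl
card-△ (true ∷ B) (true ∷ C) C⊆B = trans (+-suc _ _) (cong suc (card-△ B C C⊆B))
card-△ (true ∷ B) (false ∷ C) C⊆B = cong suc (card-△ B C C⊆B)
card-△ (false ∷ B) (false ∷ C) C⊆B = card-△ B C C⊆B

count-subsets : ∀ {n} (B : Subset n) → sumˢ (λ C → ⟦ subsetᵇ C B ⟧) ≡ 2 ^ card B
count-subsets [] = refl
count-subsets (true ∷ B) = trans (cong₂ _+_ (count-subsets B) (count-subsets B))
  (cong (2 ^ card B +_) (sym (+-identityʳ _)))
count-subsets {suc n} (false ∷ B) = cong₂ _+_ (sumˢ-zero n) (count-subsets B)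

count-supersets-same-size : ∀ {n} (A : Subset n) (g : Subset n → Bool) →
  sumˢ (λ B → ⟦ subsetᵇ A B ∧ ((card B ≡ᵇ card A) ∧ g B) ⟧) ≡ ⟦ g A ⟧
count-supersets-same-size [] g with g []
... | true = refl
... | false = refl
count-supersets-same-size {suc n} (true ∷ A) g = begin
  sumˢ (λ B → ⟦ subsetᵇ A B ∧ ((card B ≡ᵇ card A) ∧ g (true ∷ B)) ⟧) + sumˢ {n} (λ _ → 0)
    ≡⟨ cong₂ _+_ (count-supersets-same-size A (g ∘ (true ∷_))) (sumˢ-zero n) ⟩
  ⟦ g (true ∷ A) ⟧ + 0 ≡⟨ +-identityʳ _ ⟩
  ⟦ g (true ∷ A) ⟧ ∎
  where open ≡-Reasoning
count-supersets-same-size {suc n} (false ∷ A) g = begin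
  sumˢ (λ B → ⟦ subsetᵇ A B ∧ ((suc (card B) ≡ᵇ card A) ∧ g (true ∷ B)) ⟧)
    + sumˢ (λ B → ⟦ subsetᵇ A B ∧ ((card B ≡ᵇ card A) ∧ g (false ∷ B)) ⟧)
    ≡⟨ cong₂ _+_ (trans (sumˢ-cong too-big) (sumˢ-zero n)) (count-supersets-same-size A (g ∘ (false ∷_))) ⟩
  0 + ⟦ g (false ∷ A) ⟧ ∎
  where
  open ≡-Reasoning
  -- A ⊆ B has |A| ≤ |B| < 1 + |B| elements
  too-big : ∀ B → ⟦ subsetᵇ A B ∧ ((suc (card B) ≡ᵇ card A) ∧ g (true ∷ B)) ⟧ ≡ 0
  too-big B with subsetᵇ A B in A⊆B | suc (card B) ≡ᵇ card A in e
  ... | false | _ = refl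
  ... | true | false = refl
  ... | true | true = ⊥-elim (1+n≰n (≤-trans (≤-reflexive (≡ᵇ-sound _ _ e)) (card-mono A B A⊆B)))

-- Double counting the pairs (B, y) with R B and y ∈ B \ A, grouped by B and by
-- B \ {y}: the engine behind both recursions for block counts.
double-count : ∀ {n} (A : Subset n) (R : Subset n → Bool) → (∀ B → R B ≡ true → subsetᵇ A B ≡ true) →
  sumˢ (λ B → ⟦ R B ⟧ * (card B ∸ card A))
    ≡ sum (λ y → sumˢ (λ B → ⟦ subsetᵇ A B ∧ (not (lookup B y) ∧ R (B [ y ]≔ true)) ⟧))
double-count {n} A R R⇒A⊆ = begin
  sumˢ (λ B → ⟦ R B ⟧ * (card B ∸ card A))
    ≡⟨ sumˢ-cong by-element ⟩
  sumˢ (λ B → sum (λ y → ⟦ lookup B y ∧ (not (lookup A y) ∧ R B) ⟧))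
    ≡⟨ sumˢ-comm (λ B y → ⟦ lookup B y ∧ (not (lookup A y) ∧ R B) ⟧) ⟩
  sum (λ y → sumˢ (λ B → ⟦ lookup B y ∧ (not (lookup A y) ∧ R B) ⟧))
    ≡⟨ sum-cong-≗ (λ y → sumˢ-insert y (λ B → not (lookup A y) ∧ R B)) ⟩
  sum (λ y → sumˢ (λ B → ⟦ not (lookup B y) ∧ (not (lookup A y) ∧ R (B [ y ]≔ true)) ⟧))
    ≡⟨ sum-cong-≗ (λ y → sumˢ-cong (λ B → cong ⟦_⟧ (removed y B))) ⟩
  sum (λ y → sumˢ (λ B → ⟦ subsetᵇ A B ∧ (not (lookup B y) ∧ R (B [ y ]≔ true)) ⟧)) ∎
  where
  open ≡-Reasoning
  by-element : ∀ B → ⟦ R B ⟧ * (card B ∸ card A) ≡ sum (λ y → ⟦ lookup B y ∧ (not (lookup A y) ∧ R B) ⟧)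
  by-element B with R B in RB
  ... | false = sym (trans (sum-cong-≗ (λ y → cong ⟦_⟧ (trans (cong (lookup B y ∧_) (∧-zeroʳ _)) (∧-zeroʳ _)))) (sum-replicate-zero n))
  ... | true = begin
    1 * (card B ∸ card A) ≡⟨ *-identityˡ _ ⟩
    card B ∸ card A       ≡⟨ cong (_∸ card A) (card-difference A B (R⇒A⊆ B RB)) ⟨
    sum (λ y → ⟦ lookup B y ∧ not (lookup A y) ⟧) + card A ∸ card A ≡⟨ m+n∸n≡m _ (card A) ⟩
    sum (λ y → ⟦ lookup B y ∧ not (lookup A y) ⟧) ≡⟨ sum-cong-≗ (λ y → cong (λ b → ⟦ lookup B y ∧ b ⟧) (∧-identityʳ (not (lookup A y)))) ⟨
    sum (λ y → ⟦ lookup B y ∧ (not (lookup A y) ∧ true) ⟧) ∎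
  -- for y ∉ B, the condition y ∉ A is the same as A ⊆ B (given A ⊆ B ∪ {y})
  removed : ∀ y B → not (lookup B y) ∧ (not (lookup A y) ∧ R (B [ y ]≔ true))
                   ≡ subsetᵇ A B ∧ (not (lookup B y) ∧ R (B [ y ]≔ true))
  removed y B with lookup B y in yB | lookup A y in yA | R (B [ y ]≔ true) in RB+y
  ... | true | _ | _ = sym (∧-zeroʳ (subsetᵇ A B))
  ... | false | _ | false = trans (∧-zeroʳ _) (sym (∧-zeroʳ (subsetᵇ A B)))
  ... | false | false | true = sym (trans (∧-identityʳ _) (trans (sym (⊆-insert-∉ A B y yA)) (R⇒A⊆ _ RB+y)))
  ... | false | true | true with subsetᵇ A B in A⊆B
  ...   | false = refl
  ...   | true = ⊥-elim (true≢false (trans (sym yA) (⊆-∉ A B y A⊆B yB)))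
    where true≢false : true ≢ false
          true≢false ()

allᵇ-elim : ∀ {A : Set} (p : A → Bool) {xs x} → allᵇ p xs ≡ true → x ∈ xs → p x ≡ true
allᵇ-elim p e (here refl) = proj₁ (∧-true e)
allᵇ-elim p {y ∷ _} e (there x∈xs) = allᵇ-elim p (proj₂ (∧-true {p y} e)) x∈xs

allᵇ-intro : ∀ {A : Set} (p : A → Bool) → (∀ x → p x ≡ true) → ∀ xs → allᵇ p xs ≡ true
allᵇ-intro p h [] = refl
allᵇ-intro p h (x ∷ xs) = ∧-intro (h x) (allᵇ-intro p h xs)

allᵇ-counterexample : ∀ {A : Set} (p : A → Bool) xs → allᵇ p xs ≡ false → ∃ λ x → p x ≡ false
allᵇ-counterexample p (x ∷ xs) e with p x in px
... | false = x , px
... | true = allᵇ-counterexample p xs e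

∈-allSubsets : ∀ {n} (C : Subset n) → C ∈ allSubsets n
∈-allSubsets [] = here refl
∈-allSubsets (true ∷ C) = ∈-++⁺ˡ (∈-map⁺ (true ∷_) (∈-allSubsets C))
∈-allSubsets {suc n} (false ∷ C) = ∈-++⁺ʳ (map (true ∷_) (allSubsets n)) (∈-map⁺ (false ∷_) (∈-allSubsets C))

length-filter : ∀ {A : Set} (b : A → Bool) xs →
  length (filter (λ x → b x Bool.≟ true) xs) ≡ List.sum (map (⟦_⟧ ∘ b) xs)
length-filter b [] = refl
length-filter b (x ∷ xs) with b x
... | true = cong suc (length-filter b xs)
... | false = length-filter b xs

sum-allSubsets : ∀ n (f : Subset n → ℕ) → List.sum (map f (allSubsets n)) ≡ sumˢ f
sum-allSubsets zero f = +-identityʳ (f [])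
sum-allSubsets (suc n) f = begin
  List.sum (map f (map (true ∷_) S ++ map (false ∷_) S))
    ≡⟨ cong List.sum (map-++ f (map (true ∷_) S) (map (false ∷_) S)) ⟩
  List.sum (map f (map (true ∷_) S) ++ map f (map (false ∷_) S))
    ≡⟨ sum-++ (map f (map (true ∷_) S)) (map f (map (false ∷_) S)) ⟩
  List.sum (map f (map (true ∷_) S)) + List.sum (map f (map (false ∷_) S))
    ≡⟨ cong₂ _+_ (cong List.sum (map-∘ S)) (cong List.sum (map-∘ S)) ⟨
  List.sum (map (f ∘ (true ∷_)) S) + List.sum (map (f ∘ (false ∷_)) S)
    ≡⟨ cong₂ _+_ (sum-allSubsets n (f ∘ (true ∷_))) (sum-allSubsets n (f ∘ (false ∷_))) ⟩
  sumˢ f ∎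
  where
  open ≡-Reasoning
  S = allSubsets n

count≡sumˢ : ∀ n (b : Subset n → Bool) →
  length (filter (λ B → b B Bool.≟ true) (allSubsets n)) ≡ sumˢ (⟦_⟧ ∘ b)
count≡sumˢ n b = trans (length-filter b (allSubsets n)) (sum-allSubsets n (⟦_⟧ ∘ b))

commutativeRing : ∀ {q} → FieldOn q → CommutativeRing 0ℓ 0ℓ
commutativeRing F = record { isCommutativeRing = FieldOn.isCommutativeRing F }

-- A finite field in which 1 + 1 ≠ 0 has odd order: x ↦ -x is an involution
-- whose only fixed point is 0.
module OddCharacteristic {q : ℕ} (F : FieldOn q) where
  open FieldOn F renaming (_+_ to _⊕_; _*_ to _·_)
  open CommutativeRing (commutativeRing F) using ()
    renaming (*-identityʳ to ·-identityʳ; *-assoc to ·-assoc; distribˡ to ·-distribˡ-⊕;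
              zeroˡ to ·-zeroˡ; -‿inverseʳ to ⊕-inverseʳ)
  open RingProperties (CommutativeRing.ring (commutativeRing F)) using (-‿involutive; -0#≈0#)

  module _ (2≢0 : 1# ⊕ 1# ≢ 0#) where
    -- 2 is invertible, so x + x = x · 2 = 0 forces x = 0
    double≡0⇒≡0 : ∀ x → x ⊕ x ≡ 0# → x ≡ 0#
    double≡0⇒≡0 x x⊕x≡0 with inverse (1# ⊕ 1#) 2≢0
    ... | t , 2t≡1 = begin
      x                   ≡⟨ ·-identityʳ x ⟨
      x · 1#              ≡⟨ cong (x ·_) 2t≡1 ⟨
      x · ((1# ⊕ 1#) · t) ≡⟨ ·-assoc x (1# ⊕ 1#) t ⟨
      (x · (1# ⊕ 1#)) · t ≡⟨ cong (_· t) (trans (·-distribˡ-⊕ x 1# 1#) (cong₂ _⊕_ (·-identityʳ x) (·-identityʳ x))) ⟩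
      (x ⊕ x) · t         ≡⟨ cong (_· t) x⊕x≡0 ⟩
      0# · t              ≡⟨ ·-zeroˡ t ⟩
      0#                  ∎
      where open ≡-Reasoning

    fixed⇔zero : ∀ y → ⌊ y Fin.≟ - y ⌋ ≡ ⌊ 0# Fin.≟ y ⌋
    fixed⇔zero y = ⌊⌋-⇔ (y Fin.≟ - y) (0# Fin.≟ y)
      (λ y≡-y → sym (double≡0⇒≡0 y (trans (cong (y ⊕_) y≡-y) (⊕-inverseʳ y))))
      (λ { refl → sym -0#≈0# })

    odd-order : ∃ λ j → q ≡ suc (2 * j)
    odd-order with involution-parity -_ -‿involutive
    ... | j , q≡fix+2j = j , trans q≡fix+2j (cong (_+ 2 * j) one-fixed-point)
      where
      one-fixed-point : sum (λ y → ⟦ ⌊ y Fin.≟ - y ⌋ ⟧) ≡ 1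
      one-fixed-point = trans (sum-cong-≗ (cong ⟦_⟧ ∘ fixed⇔zero)) (sum-≟ 0#)

even-order⇒char2 : ∀ {q} (F : FieldOn q) k → q ≡ 2 * k →
  FieldOn._+_ F (FieldOn.1# F) (FieldOn.1# F) ≡ FieldOn.0# F
even-order⇒char2 F k q≡2k with FieldOn._+_ F (FieldOn.1# F) (FieldOn.1# F) Fin.≟ FieldOn.0# F
... | yes 2≡0 = 2≡0
... | no 2≢0 with OddCharacteristic.odd-order F 2≢0
...   | j , q≡1+2j = ⊥-elim (even≢odd k j (trans (sym q≡2k) q≡1+2j))

-- From here on F is a field on Fin q of characteristic 2.  Its additive group is
-- an 𝔽₂-vector space; the whole argument is linear algebra over 𝔽₂ in it.
module CharTwo {q : ℕ} (F : FieldOn q)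
               (char2 : FieldOn._+_ F (FieldOn.1# F) (FieldOn.1# F) ≡ FieldOn.0# F) where
  open FieldOn F using (0#; 1#; 0≢1) renaming (_+_ to _⊕_; _*_ to _·_)
  open CommutativeRing (commutativeRing F) using (+-commutativeMonoid)
    renaming (+-assoc to ⊕-assoc; +-comm to ⊕-comm; +-identityˡ to ⊕-identityˡ;
              +-identityʳ to ⊕-identityʳ; *-identityʳ to ·-identityʳ; distribˡ to ·-distribˡ-⊕;
              zeroʳ to ·-zeroʳ)
  open CommutativeSemigroupProperties (CommutativeMonoid.commutativeSemigroup +-commutativeMonoid)
    using () renaming (interchange to ⊕-interchange; x∙yz≈y∙xz to ⊕-leftComm)

  x⊕x≡0 : ∀ x → x ⊕ x ≡ 0#
  x⊕x≡0 x = begin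
    x ⊕ x               ≡⟨ cong₂ _⊕_ (·-identityʳ x) (·-identityʳ x) ⟨
    (x · 1#) ⊕ (x · 1#) ≡⟨ ·-distribˡ-⊕ x 1# 1# ⟨
    x · (1# ⊕ 1#)       ≡⟨ cong (x ·_) char2 ⟩
    x · 0#              ≡⟨ ·-zeroʳ x ⟩
    0#                  ∎
    where open ≡-Reasoning

  ⊕-cancelˡ : ∀ a b → a ⊕ (a ⊕ b) ≡ b
  ⊕-cancelˡ a b = trans (sym (⊕-assoc a a b)) (trans (cong (_⊕ b) (x⊕x≡0 a)) (⊕-identityˡ b))

  ⊕-solveʳ : ∀ {a b c} → a ⊕ b ≡ c → b ≡ a ⊕ c
  ⊕-solveʳ {a} {b} e = trans (sym (⊕-cancelˡ a b)) (cong (a ⊕_) e)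

  ⊕-solveˡ : ∀ {a b c} → a ⊕ b ≡ c → a ≡ b ⊕ c
  ⊕-solveˡ {a} {b} e = ⊕-solveʳ (trans (⊕-comm b a) e)

  ⊕≡0⇒≡ : ∀ {a b} → a ⊕ b ≡ 0# → a ≡ b
  ⊕≡0⇒≡ {a} {b} e = trans (⊕-solveˡ e) (⊕-identityʳ b)

  -- ∑_{i ∈ B} φ i.  The labelling φ lets the definition recurse along B.
  sumOver : ∀ {n} → (Fin n → Fin q) → Subset n → Fin q
  sumOver φ [] = 0#
  sumOver φ (true ∷ B) = φ zero ⊕ sumOver (φ ∘ suc) B
  sumOver φ (false ∷ B) = sumOver (φ ∘ suc) B

  ∑ : Subset q → Fin q
  ∑ = sumOver id

  sumOver-△ : ∀ {n} (φ : Fin n → Fin q) C D → sumOver φ (C △ D) ≡ sumOver φ C ⊕ sumOver φ D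
  sumOver-△ φ [] [] = sym (⊕-identityˡ 0#)
  sumOver-△ φ (true ∷ C) (true ∷ D) = begin
    sumOver (φ ∘ suc) (C △ D)                             ≡⟨ sumOver-△ (φ ∘ suc) C D ⟩
    sumOver (φ ∘ suc) C ⊕ sumOver (φ ∘ suc) D             ≡⟨ ⊕-identityˡ _ ⟨
    0# ⊕ (sumOver (φ ∘ suc) C ⊕ sumOver (φ ∘ suc) D)      ≡⟨ cong (_⊕ (sumOver (φ ∘ suc) C ⊕ sumOver (φ ∘ suc) D)) (x⊕x≡0 (φ zero)) ⟨
    (φ zero ⊕ φ zero) ⊕ (sumOver (φ ∘ suc) C ⊕ sumOver (φ ∘ suc) D) ≡⟨ ⊕-interchange _ _ _ _ ⟩
    (φ zero ⊕ sumOver (φ ∘ suc) C) ⊕ (φ zero ⊕ sumOver (φ ∘ suc) D) ∎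
    where open ≡-Reasoning
  sumOver-△ φ (true ∷ C) (false ∷ D) = trans (cong (φ zero ⊕_) (sumOver-△ (φ ∘ suc) C D)) (sym (⊕-assoc _ _ _))
  sumOver-△ φ (false ∷ C) (true ∷ D) = trans (cong (φ zero ⊕_) (sumOver-△ (φ ∘ suc) C D)) (⊕-leftComm _ _ _)
  sumOver-△ φ (false ∷ C) (false ∷ D) = sumOver-△ (φ ∘ suc) C D

  sumOver-insert : ∀ {n} (φ : Fin n → Fin q) B y → lookup B y ≡ false →
    sumOver φ (B [ y ]≔ true) ≡ φ y ⊕ sumOver φ B
  sumOver-insert φ (false ∷ B) zero _ = refl
  sumOver-insert φ (true ∷ B) (suc y) y∉B =
    trans (cong (φ zero ⊕_) (sumOver-insert (φ ∘ suc) B y y∉B)) (⊕-leftComm _ _ _)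
  sumOver-insert φ (false ∷ B) (suc y) y∉B = sumOver-insert (φ ∘ suc) B y y∉B

  sumOver-card0 : ∀ {n} (φ : Fin n → Fin q) C → card C ≡ 0 → sumOver φ C ≡ 0#
  sumOver-card0 φ [] _ = refl
  sumOver-card0 φ (false ∷ C) e = sumOver-card0 (φ ∘ suc) C e

  sumOver-⁅⁆ : ∀ {n} (φ : Fin n → Fin q) x → sumOver φ ⁅ x ⁆ ≡ φ x
  sumOver-⁅⁆ {suc n} φ zero = trans (cong (φ zero ⊕_) (sumOver-card0 (φ ∘ suc) ∅ (card-∅ n))) (⊕-identityʳ (φ zero))
  sumOver-⁅⁆ φ (suc x) = sumOver-⁅⁆ (φ ∘ suc) x

  ∑-remove : ∀ E y → lookup E y ≡ true → ∑ E ≡ y ⊕ ∑ (E [ y ]≔ false)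
  ∑-remove E y y∈E = trans (cong ∑ (sym (remove-insert E y y∈E)))
    (sumOver-insert id (E [ y ]≔ false) y (lookup∘update y E false))

  ∑-card1 : ∀ E → card E ≡ 1 → ∃ λ i → lookup E i ≡ true × ∑ E ≡ i
  ∑-card1 E |E|≡1 with card-witness E (≤-reflexive (sym |E|≡1))
  ... | i , i∈E = i , i∈E , (begin
    ∑ E                   ≡⟨ ∑-remove E i i∈E ⟩
    i ⊕ ∑ (E [ i ]≔ false) ≡⟨ cong (i ⊕_) (sumOver-card0 id (E [ i ]≔ false) (suc-injective (trans (sym (card-remove E i i∈E)) |E|≡1))) ⟩
    i ⊕ 0#                ≡⟨ ⊕-identityʳ i ⟩
    i                     ∎)
    where open ≡-Reasoning

  ∑-card2 : ∀ E → card E ≡ 2 → ∑ E ≢ 0#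
  ∑-card2 E |E|≡2 ∑E≡0 with card-witness E (≤-trans (s≤s z≤n) (≤-reflexive (sym |E|≡2)))
  ... | i , i∈E with ∑-card1 (E [ i ]≔ false) (suc-injective (trans (sym (card-remove E i i∈E)) |E|≡2))
  ... | j , j∈E-i , ∑≡j = distinct (⊕≡0⇒≡ (trans (cong (i ⊕_) (sym ∑≡j)) (trans (sym (∑-remove E i i∈E)) ∑E≡0)))
    where
    distinct : i ≢ j
    distinct refl with trans (sym j∈E-i) (lookup∘update i E false)
    ... | ()

  in01ᵇ : Fin q → Bool
  in01ᵇ a = ⌊ a Fin.≟ 0# ⌋ ∨ ⌊ a Fin.≟ 1# ⌋

  in01ᵇ-sound : ∀ a → in01ᵇ a ≡ true → a ≡ 0# ⊎ a ≡ 1#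
  in01ᵇ-sound a e with a Fin.≟ 0# | a Fin.≟ 1#
  ... | yes a≡0 | _ = inj₁ a≡0
  ... | no _ | yes a≡1 = inj₂ a≡1

  in01ᵇ-complete : ∀ a → a ≡ 0# ⊎ a ≡ 1# → in01ᵇ a ≡ true
  in01ᵇ-complete a (inj₁ a≡0) = cong (_∨ ⌊ a Fin.≟ 1# ⌋) (⌊⌋-yes (a Fin.≟ 0#) a≡0)
  in01ᵇ-complete a (inj₂ a≡1) = trans (cong (⌊ a Fin.≟ 0# ⌋ ∨_) (⌊⌋-yes (a Fin.≟ 1#) a≡1)) (∨-zeroʳ _)

  -- B is independent when no nonempty C ⊆ B has ∑ C ∈ {0, 1}; equivalently
  -- 1 ∉ B and B ∪ {1} is linearly independent over 𝔽₂.
  Independent : Subset q → Set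
  Independent B = ∀ C → subsetᵇ C B ≡ true → (∑ C ≡ 0# ⊎ ∑ C ≡ 1#) → card C ≡ 0

  noWitnessᵇ : Subset q → Subset q → Bool
  noWitnessᵇ B C = not (subsetᵇ C B ∧ in01ᵇ (∑ C)) ∨ (card C ≡ᵇ 0)

  independentᵇ : Subset q → Bool
  independentᵇ B = allᵇ (noWitnessᵇ B) (allSubsets q)

  independentᵇ-sound : ∀ B → independentᵇ B ≡ true → Independent B
  independentᵇ-sound B e C C⊆B in01 = ≡ᵇ-sound (card C) 0
    (subst (λ b → not b ∨ (card C ≡ᵇ 0) ≡ true) (cong₂ _∧_ C⊆B (in01ᵇ-complete (∑ C) in01))
      (allᵇ-elim (noWitnessᵇ B) e (∈-allSubsets C)))

  independentᵇ-complete : ∀ B → Independent B → independentᵇ B ≡ true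
  independentᵇ-complete B ind = allᵇ-intro (noWitnessᵇ B) no-witness (allSubsets q)
    where
    no-witness : ∀ C → noWitnessᵇ B C ≡ true
    no-witness C with subsetᵇ C B in C⊆B | in01ᵇ (∑ C) in in01
    ... | false | _ = refl
    ... | true | false = refl
    ... | true | true = ≡ᵇ-complete (ind C C⊆B (in01ᵇ-sound (∑ C) in01))

  dependence-witness : ∀ B → independentᵇ B ≡ false →
    ∃ λ C → subsetᵇ C B ≡ true × (∑ C ≡ 0# ⊎ ∑ C ≡ 1#) × 1 ≤ card C
  dependence-witness B e with allᵇ-counterexample (noWitnessᵇ B) (allSubsets q) e
  ... | C , bad = C , witness bad
    where
    witness : noWitnessᵇ B C ≡ false → subsetᵇ C B ≡ true × (∑ C ≡ 0# ⊎ ∑ C ≡ 1#) × 1 ≤ card C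
    witness bad with subsetᵇ C B | in01ᵇ (∑ C) in in01 | card C
    witness () | false | _ | _
    witness () | true | false | _
    witness () | true | true | zero
    witness _ | true | true | suc _ = refl , in01ᵇ-sound (∑ C) in01 , s≤s z≤n

  independent-shrink : ∀ B y → Independent (B [ y ]≔ true) → Independent B
  independent-shrink B y ind C C⊆B = ind C (⊆-insert C B y C⊆B)

  -- C ⊆ B represents y when ∑ C ∈ {y, y ⊕ 1}: then y lies in the 𝔽₂-span of B ∪ {1}.
  represents : Subset q → Fin q → Subset q → ℕ
  represents B y C = ⟦ subsetᵇ C B ⟧ * (⟦ ⌊ ∑ C Fin.≟ y ⌋ ⟧ + ⟦ ⌊ ∑ C ⊕ 1# Fin.≟ y ⌋ ⟧)

  representations : Subset q → Fin q → ℕ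
  representations B y = sumˢ (represents B y)

  -- Each of the 2^|B| subsets of B represents exactly two elements, ∑ C and ∑ C ⊕ 1.
  sum-representations : ∀ B → sum (representations B) ≡ 2 ^ suc (card B)
  sum-representations B = begin
    sum (λ y → sumˢ (λ C → represents B y C)) ≡⟨ sumˢ-comm (λ C y → represents B y C) ⟨
    sumˢ (λ C → sum (λ y → represents B y C)) ≡⟨ sumˢ-cong two-each ⟩
    sumˢ (λ C → 2 * ⟦ subsetᵇ C B ⟧)          ≡⟨ sumˢ-distribˡ 2 (λ C → ⟦ subsetᵇ C B ⟧) ⟩
    2 * sumˢ (λ C → ⟦ subsetᵇ C B ⟧)          ≡⟨ cong (2 *_) (count-subsets B) ⟩
    2 ^ suc (card B)                          ∎
    where
    open ≡-Reasoning
    two-each : ∀ C → sum (λ y → represents B y C) ≡ 2 * ⟦ subsetᵇ C B ⟧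
    two-each C = begin
      sum (λ y → ⟦ subsetᵇ C B ⟧ * (⟦ ⌊ ∑ C Fin.≟ y ⌋ ⟧ + ⟦ ⌊ ∑ C ⊕ 1# Fin.≟ y ⌋ ⟧))
        ≡⟨ *-distribˡ-sum ⟦ subsetᵇ C B ⟧ (λ y → ⟦ ⌊ ∑ C Fin.≟ y ⌋ ⟧ + ⟦ ⌊ ∑ C ⊕ 1# Fin.≟ y ⌋ ⟧) ⟨
      ⟦ subsetᵇ C B ⟧ * sum (λ y → ⟦ ⌊ ∑ C Fin.≟ y ⌋ ⟧ + ⟦ ⌊ ∑ C ⊕ 1# Fin.≟ y ⌋ ⟧)
        ≡⟨ cong (⟦ subsetᵇ C B ⟧ *_) (∑-distrib-+ (λ y → ⟦ ⌊ ∑ C Fin.≟ y ⌋ ⟧) (λ y → ⟦ ⌊ ∑ C ⊕ 1# Fin.≟ y ⌋ ⟧)) ⟩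
      ⟦ subsetᵇ C B ⟧ * (sum (λ y → ⟦ ⌊ ∑ C Fin.≟ y ⌋ ⟧) + sum (λ y → ⟦ ⌊ ∑ C ⊕ 1# Fin.≟ y ⌋ ⟧))
        ≡⟨ cong (⟦ subsetᵇ C B ⟧ *_) (cong₂ _+_ (sum-≟ (∑ C)) (sum-≟ (∑ C ⊕ 1#))) ⟩
      ⟦ subsetᵇ C B ⟧ * 2 ≡⟨ *-comm ⟦ subsetᵇ C B ⟧ 2 ⟩
      2 * ⟦ subsetᵇ C B ⟧ ∎

  1≢0 : 1# ≢ 0#
  1≢0 = 0≢1 ∘ sym

  -- ∑ C and ∑ C ⊕ 1 differ, so C represents y at most once.
  represents≤1 : ∀ B y C → represents B y C ≤ 1
  represents≤1 B y C with subsetᵇ C B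
  ... | false = z≤n
  ... | true with ⌊ ∑ C Fin.≟ y ⌋ in e₀ | ⌊ ∑ C ⊕ 1# Fin.≟ y ⌋ in e₁
  ...   | false | false = z≤n
  ...   | false | true = ≤-refl
  ...   | true | false = ≤-refl
  ...   | true | true = ⊥-elim (1≢0 (trans (⊕-solveʳ (trans (⌊⌋-true _ e₁) (sym (⌊⌋-true _ e₀)))) (x⊕x≡0 (∑ C))))

  represents-sound : ∀ B y C → 1 ≤ represents B y C → subsetᵇ C B ≡ true × (∑ C ≡ y ⊎ ∑ C ≡ 1# ⊕ y)
  represents-sound B y C p with subsetᵇ C B
  represents-sound B y C () | false
  ... | true with ⌊ ∑ C Fin.≟ y ⌋ in e₀ | ⌊ ∑ C ⊕ 1# Fin.≟ y ⌋ in e₁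
  ...   | true | _ = refl , inj₁ (⌊⌋-true _ e₀)
  ...   | false | true = refl , inj₂ (⊕-solveʳ (trans (⊕-comm 1# (∑ C)) (⌊⌋-true _ e₁)))
  represents-sound B y C () | true | false | false

  represents-complete : ∀ B y C → subsetᵇ C B ≡ true → (∑ C ≡ y ⊎ ∑ C ⊕ 1# ≡ y) → 1 ≤ represents B y C
  represents-complete B y C C⊆B ∑C rewrite C⊆B with ∑C
  ... | inj₁ e rewrite ⌊⌋-yes (∑ C Fin.≟ y) e = s≤s z≤n
  ... | inj₂ e with ⌊ ∑ C Fin.≟ y ⌋
  ...   | true = s≤s z≤n
  ...   | false rewrite ⌊⌋-yes (∑ C ⊕ 1# Fin.≟ y) e = s≤s z≤n

  sum-of-representatives : ∀ y {a b} → (a ≡ y ⊎ a ≡ 1# ⊕ y) → (b ≡ y ⊎ b ≡ 1# ⊕ y) → a ⊕ b ≡ 0# ⊎ a ⊕ b ≡ 1#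
  sum-of-representatives y (inj₁ refl) (inj₁ refl) = inj₁ (x⊕x≡0 y)
  sum-of-representatives y (inj₁ refl) (inj₂ refl) = inj₂ (trans (⊕-leftComm y 1# y) (trans (cong (1# ⊕_) (x⊕x≡0 y)) (⊕-identityʳ 1#)))
  sum-of-representatives y (inj₂ refl) (inj₁ refl) = inj₂ (trans (⊕-assoc 1# y y) (trans (cong (1# ⊕_) (x⊕x≡0 y)) (⊕-identityʳ 1#)))
  sum-of-representatives y (inj₂ refl) (inj₂ refl) = inj₁ (x⊕x≡0 (1# ⊕ y))

  -- Over an independent B representations are unique: two of them differ by a
  -- subset of B summing to 0 or 1.
  representations≤1 : ∀ B → Independent B → ∀ y → representations B y ≤ 1
  representations≤1 B ind y = sumˢ-atMostOne (represents B y) (represents≤1 B y) unique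
    where
    unique : ∀ C D → 1 ≤ represents B y C → 1 ≤ represents B y D → C ≡ D
    unique C D rC rD with represents-sound B y C rC | represents-sound B y D rD
    ... | C⊆B , ∑C | D⊆B , ∑D = △-empty C D (ind (C △ D) (△-⊆ C D B C⊆B D⊆B)
            (subst (λ a → a ≡ 0# ⊎ a ≡ 1#) (sym (sumOver-△ id C D)) (sum-of-representatives y ∑C ∑D)))

  -- A representation of y ∉ B by C makes C ∪ {y} a dependence of B ∪ {y}.
  representation⇒dependent : ∀ B y → lookup B y ≡ false → 1 ≤ representations B y →
    ¬ Independent (B [ y ]≔ true)
  representation⇒dependent B y y∉B r ind with sumˢ-witness (represents B y) r
  ... | C , rC with represents-sound B y C rC
  ... | C⊆B , ∑C with ind (C [ y ]≔ true) (⊆-insert₂ C B y C⊆B)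
          (subst (λ a → a ≡ 0# ⊎ a ≡ 1#) (sym (sumOver-insert id C y y∉C)) (sum-of-representatives y (inj₁ refl) ∑C))
    where y∉C = ⊆-∉ C B y C⊆B y∉B
  ... | |C+y|≡0 with trans (sym (card-insert C y (⊆-∉ C B y C⊆B y∉B))) |C+y|≡0
  ...   | ()

  -- Conversely a dependence of B ∪ {y} must use y, and the rest of it represents y.
  dependent⇒representation : ∀ B y → Independent B → lookup B y ≡ false →
    independentᵇ (B [ y ]≔ true) ≡ false → 1 ≤ representations B y
  dependent⇒representation B y ind y∉B dep with dependence-witness _ dep
  ... | E , E⊆B+y , ∑E , |E|≥1 with lookup E y in y∈E
  ... | false = ⊥-elim (<⇒≢ |E|≥1 (sym (ind E (trans (sym (⊆-insert-∉ E B y y∈E)) E⊆B+y) ∑E)))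
  ... | true = ≤-trans (represented (subst (λ a → a ≡ 0# ⊎ a ≡ 1#) (∑-remove E y y∈E) ∑E))
                       (term≤sumˢ (represents B y) C)
    where
    C = E [ y ]≔ false
    represented : (y ⊕ ∑ C ≡ 0# ⊎ y ⊕ ∑ C ≡ 1#) → 1 ≤ represents B y C
    represented (inj₁ e) = represents-complete B y C (⊆-remove E B y E⊆B+y) (inj₁ (sym (⊕≡0⇒≡ e)))
    represented (inj₂ e) = represents-complete B y C (⊆-remove E B y E⊆B+y) (inj₂ (sym (⊕-solveˡ e)))

  member⇒representation : ∀ B y → lookup B y ≡ true → 1 ≤ representations B y
  member⇒representation B y y∈B = ≤-trans
    (represents-complete B y ⁅ y ⁆ (trans (⁅⁆-⊆ B y) y∈B) (inj₁ (sumOver-⁅⁆ id y)))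
    (term≤sumˢ (represents B y) ⁅ y ⁆)

  -- For independent B, adding y keeps B independent exactly when y is not
  -- represented, i.e. y lies outside span(B ∪ {1}).
  extension-indicator : ∀ B → Independent B → ∀ y →
    ⟦ not (lookup B y) ∧ independentᵇ (B [ y ]≔ true) ⟧ ≡ 1 ∸ representations B y
  extension-indicator B ind y with lookup B y in y∈B | independentᵇ (B [ y ]≔ true) in indB+y
  ... | true | _ = sym (m≤n⇒m∸n≡0 (member⇒representation B y y∈B))
  ... | false | false = sym (m≤n⇒m∸n≡0 (dependent⇒representation B y ind y∈B indB+y))
  ... | false | true with representations B y in r
  ...   | zero = refl
  ...   | suc _ = ⊥-elim (representation⇒dependent B y y∈B (subst (1 ≤_) (sym r) (s≤s z≤n))
                           (independentᵇ-sound _ indB+y))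

  -- An independent k-set has q ∸ 2^(k+1) independent one-point extensions
  -- (all of F minus the span of B ∪ {1}); a dependent set has none.
  count-extensions : ∀ B → sum (λ y → ⟦ not (lookup B y) ∧ independentᵇ (B [ y ]≔ true) ⟧)
                           ≡ ⟦ independentᵇ B ⟧ * (q ∸ 2 ^ suc (card B))
  count-extensions B with independentᵇ B in indB
  ... | true = begin
    sum (λ y → ⟦ not (lookup B y) ∧ independentᵇ (B [ y ]≔ true) ⟧)
      ≡⟨ sum-cong-≗ (extension-indicator B ind) ⟩
    sum (λ y → 1 ∸ representations B y)  ≡⟨ sum-complement (representations B) (representations≤1 B ind) ⟩
    q ∸ sum (representations B)          ≡⟨ cong (q ∸_) (sum-representations B) ⟩
    q ∸ 2 ^ suc (card B)                 ≡⟨ +-identityʳ _ ⟨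
    1 * (q ∸ 2 ^ suc (card B))           ∎
    where
    open ≡-Reasoning
    ind = independentᵇ-sound B indB
  ... | false = trans (sum-cong-≗ no-extension) (sum-replicate-zero q)
    where
    no-extension : ∀ y → ⟦ not (lookup B y) ∧ independentᵇ (B [ y ]≔ true) ⟧ ≡ 0
    no-extension y with independentᵇ (B [ y ]≔ true) in indB+y
    ... | false = cong ⟦_⟧ (∧-zeroʳ _)
    ... | true with trans (sym indB) (independentᵇ-complete B (independent-shrink B y (independentᵇ-sound _ indB+y)))
    ...   | ()

  independentSupersetᵇ : Subset q → ℕ → Subset q → Bool
  independentSupersetᵇ A k B = subsetᵇ A B ∧ ((card B ≡ᵇ k) ∧ independentᵇ B)

  independentSupersets : Subset q → ℕ → ℕ
  independentSupersets A k = sumˢ (λ B → ⟦ independentSupersetᵇ A k B ⟧)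

  superset-extension : ∀ A k B y →
    ⟦ subsetᵇ A B ∧ (not (lookup B y) ∧ independentSupersetᵇ A (suc k) (B [ y ]≔ true)) ⟧
      ≡ ⟦ subsetᵇ A B ∧ (card B ≡ᵇ k) ⟧ * ⟦ not (lookup B y) ∧ independentᵇ (B [ y ]≔ true) ⟧
  superset-extension A k B y with lookup B y in y∈B
  ... | true = trans (cong ⟦_⟧ (∧-zeroʳ (subsetᵇ A B))) (sym (*-zeroʳ ⟦ subsetᵇ A B ∧ (card B ≡ᵇ k) ⟧))
  ... | false rewrite card-insert B y y∈B with subsetᵇ A B in A⊆B
  ...   | false = refl
  ...   | true rewrite ⊆-insert A B y A⊆B = ⟦∧⟧ (card B ≡ᵇ k) (independentᵇ (B [ y ]≔ true))

  superset-size : ∀ A k B → ⟦ subsetᵇ A B ∧ (card B ≡ᵇ k) ⟧ * (⟦ independentᵇ B ⟧ * (q ∸ 2 ^ suc (card B)))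
                            ≡ ⟦ independentSupersetᵇ A k B ⟧ * (q ∸ 2 ^ suc k)
  superset-size A k B with card B ≡ᵇ k in |B|≡k
  ... | false = trans (cong (λ b → ⟦ b ⟧ * _) (∧-zeroʳ (subsetᵇ A B)))
                      (sym (cong (λ b → ⟦ b ⟧ * _) (∧-zeroʳ (subsetᵇ A B))))
  ... | true rewrite ≡ᵇ-sound (card B) k |B|≡k = begin
    ⟦ subsetᵇ A B ∧ true ⟧ * (⟦ independentᵇ B ⟧ * (q ∸ 2 ^ suc k)) ≡⟨ *-assoc ⟦ subsetᵇ A B ∧ true ⟧ _ _ ⟨
    ⟦ subsetᵇ A B ∧ true ⟧ * ⟦ independentᵇ B ⟧ * (q ∸ 2 ^ suc k)   ≡⟨ cong (_* (q ∸ 2 ^ suc k)) (⟦∧⟧ (subsetᵇ A B ∧ true) (independentᵇ B)) ⟨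
    ⟦ (subsetᵇ A B ∧ true) ∧ independentᵇ B ⟧ * (q ∸ 2 ^ suc k)    ≡⟨ cong (λ b → ⟦ b ⟧ * (q ∸ 2 ^ suc k)) (∧-assoc (subsetᵇ A B) true (independentᵇ B)) ⟩
    ⟦ subsetᵇ A B ∧ (true ∧ independentᵇ B) ⟧ * (q ∸ 2 ^ suc k)    ∎
    where open ≡-Reasoning

  independentSupersets-step : ∀ A k →
    independentSupersets A (suc k) * (suc k ∸ card A) ≡ independentSupersets A k * (q ∸ 2 ^ suc k)
  independentSupersets-step A k = begin
    independentSupersets A (suc k) * (suc k ∸ card A)
      ≡⟨ sumˢ-distribʳ (λ B → ⟦ P (suc k) B ⟧) (suc k ∸ card A) ⟨
    sumˢ (λ B → ⟦ P (suc k) B ⟧ * (suc k ∸ card A))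
      ≡⟨ sumˢ-cong size ⟨
    sumˢ (λ B → ⟦ P (suc k) B ⟧ * (card B ∸ card A))
      ≡⟨ double-count A (P (suc k)) (λ B → proj₁ ∘ ∧-true) ⟩
    sum (λ y → sumˢ (λ B → ⟦ subsetᵇ A B ∧ (not (lookup B y) ∧ P (suc k) (B [ y ]≔ true)) ⟧))
      ≡⟨ sum-cong-≗ (λ y → sumˢ-cong (λ B → superset-extension A k B y)) ⟩
    sum (λ y → sumˢ (λ B → ⟦ subsetᵇ A B ∧ (card B ≡ᵇ k) ⟧ * ext B y))
      ≡⟨ sumˢ-comm (λ B y → ⟦ subsetᵇ A B ∧ (card B ≡ᵇ k) ⟧ * ext B y) ⟨
    sumˢ (λ B → sum (λ y → ⟦ subsetᵇ A B ∧ (card B ≡ᵇ k) ⟧ * ext B y))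
      ≡⟨ sumˢ-cong (λ B → *-distribˡ-sum ⟦ subsetᵇ A B ∧ (card B ≡ᵇ k) ⟧ (ext B)) ⟨
    sumˢ (λ B → ⟦ subsetᵇ A B ∧ (card B ≡ᵇ k) ⟧ * sum (ext B))
      ≡⟨ sumˢ-cong (λ B → cong (⟦ subsetᵇ A B ∧ (card B ≡ᵇ k) ⟧ *_) (count-extensions B)) ⟩
    sumˢ (λ B → ⟦ subsetᵇ A B ∧ (card B ≡ᵇ k) ⟧ * (⟦ independentᵇ B ⟧ * (q ∸ 2 ^ suc (card B))))
      ≡⟨ sumˢ-cong (superset-size A k) ⟩
    sumˢ (λ B → ⟦ P k B ⟧ * (q ∸ 2 ^ suc k))
      ≡⟨ sumˢ-distribʳ (λ B → ⟦ P k B ⟧) (q ∸ 2 ^ suc k) ⟩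
    independentSupersets A k * (q ∸ 2 ^ suc k) ∎
    where
    open ≡-Reasoning
    P = independentSupersetᵇ A
    ext : Subset q → Fin q → ℕ
    ext B y = ⟦ not (lookup B y) ∧ independentᵇ (B [ y ]≔ true) ⟧
    size : ∀ B → ⟦ P (suc k) B ⟧ * (card B ∸ card A) ≡ ⟦ P (suc k) B ⟧ * (suc k ∸ card A)
    size B with P (suc k) B in PB
    ... | false = refl
    ... | true = cong (λ c → 1 * (c ∸ card A)) (≡ᵇ-sound _ _ (proj₁ (∧-true (proj₂ (∧-true {subsetᵇ A B} PB)))))

  open Blocks F using (W; Wf; inXᵇ; subXᵇ; sumSub; eqᵇ; sizeW; repW)

  sumSub≡∑ : ∀ B → sumSub B ≡ ∑ B
  sumSub≡∑ B = trans (fold-tabulate id) (cong ∑ (tabulate∘lookup B))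
    where
    fold-tabulate : ∀ {n} (f : Fin n → Fin q) →
      Data.List.foldr (λ i acc → if lookup B i then i ⊕ acc else acc) 0# (Data.List.tabulate f)
        ≡ sumOver f (Data.Vec.tabulate (lookup B ∘ f))
    fold-tabulate {zero} f = refl
    fold-tabulate {suc n} f with lookup B (f zero)
    ... | true = cong (f zero ⊕_) (fold-tabulate (f ∘ suc))
    ... | false = fold-tabulate (f ∘ suc)

  InX : Fin q → Set
  InX i = ¬ (i ≡ 0# ⊎ i ≡ 1#)

  inXᵇ-sound : ∀ i → inXᵇ i ≡ true → InX i
  inXᵇ-sound i e with i Fin.≟ 0# | i Fin.≟ 1#
  inXᵇ-sound i () | yes _ | _
  inXᵇ-sound i () | no _ | yes _
  ... | no i≢0 | no i≢1 = λ { (inj₁ i≡0) → i≢0 i≡0 ; (inj₂ i≡1) → i≢1 i≡1 }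

  inXᵇ-complete : ∀ i → InX i → inXᵇ i ≡ true
  inXᵇ-complete i i∈X rewrite ⌊⌋-no (i Fin.≟ 0#) (i∈X ∘ inj₁) | ⌊⌋-no (i Fin.≟ 1#) (i∈X ∘ inj₂) = refl

  subXᵇ-sound : ∀ B → subXᵇ B ≡ true → ∀ i → lookup B i ≡ true → InX i
  subXᵇ-sound B e i i∈B = inXᵇ-sound i
    (subst (λ b → not b ∨ inXᵇ i ≡ true) i∈B (allᵇ-elim (λ i → not (lookup B i) ∨ inXᵇ i) e (∈-allFin i)))

  subXᵇ-complete : ∀ B → (∀ i → lookup B i ≡ true → InX i) → subXᵇ B ≡ true
  subXᵇ-complete B B⊆X = allᵇ-intro (λ i → not (lookup B i) ∨ inXᵇ i) member (allFin q)
    where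
    member : ∀ i → not (lookup B i) ∨ inXᵇ i ≡ true
    member i with lookup B i in i∈B
    ... | false = refl
    ... | true = inXᵇ-complete i (B⊆X i i∈B)

  avoidsᵇ : ℕ → Subset q → Bool
  avoidsᵇ ℓ B = allᵇ (λ C → not (subsetᵇ C B ∧ ⌊ card C Nat.≟ ℓ ⌋) ∨ not (Wf 6 ℓ C)) (allSubsets q)

  W7-unfold : ∀ B → W 7 B ≡ subXᵇ B ∧ (⌊ card B Nat.≟ 7 ⌋ ∧ (eqᵇ (sumSub B) 1# ∧
                                 (avoidsᵇ 2 B ∧ (avoidsᵇ 3 B ∧ (avoidsᵇ 4 B ∧ true)))))
  W7-unfold B = refl

  -- Blocks of size ℓ ≤ 4 have no recursive clause (it concerns 2 ≤ ℓ' ≤ ℓ - 3).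
  SmallLevel : ℕ → Set
  SmallLevel ℓ = ∀ C → Wf 6 ℓ C ≡ subXᵇ C ∧ (⌊ card C Nat.≟ ℓ ⌋ ∧ (eqᵇ (sumSub C) 1# ∧ true))

  small-2 : SmallLevel 2
  small-2 C = refl
  small-3 : SmallLevel 3
  small-3 C = refl
  small-4 : SmallLevel 4
  small-4 C = refl

  avoidsᵇ-sound : ∀ ℓ → SmallLevel ℓ → ∀ B → subXᵇ B ≡ true → avoidsᵇ ℓ B ≡ true →
    ∀ C → subsetᵇ C B ≡ true → card C ≡ ℓ → ∑ C ≢ 1#
  avoidsᵇ-sound ℓ small B B⊆X e C C⊆B |C|≡ℓ ∑C≡1 = contradiction (allᵇ-elim _ e (∈-allSubsets C))
    where
    C⊆X : subXᵇ C ≡ true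
    C⊆X = subXᵇ-complete C (λ i i∈C → subXᵇ-sound B B⊆X i (⊆-∈ C B i C⊆B i∈C))
    contradiction : not (subsetᵇ C B ∧ ⌊ card C Nat.≟ ℓ ⌋) ∨ not (Wf 6 ℓ C) ≡ true → ⊥
    contradiction r rewrite small C | C⊆B | C⊆X | ⌊⌋-yes (card C Nat.≟ ℓ) |C|≡ℓ
                          | ⌊⌋-yes (sumSub C Fin.≟ 1#) (trans (sumSub≡∑ C) ∑C≡1) with r
    ... | ()

  avoidsᵇ-complete : ∀ ℓ → SmallLevel ℓ → ∀ B →
    (∀ C → subsetᵇ C B ≡ true → card C ≡ ℓ → ∑ C ≢ 1#) → avoidsᵇ ℓ B ≡ true
  avoidsᵇ-complete ℓ small B no-1 = allᵇ-intro _ avoided (allSubsets q)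
    where
    avoided : ∀ C → not (subsetᵇ C B ∧ ⌊ card C Nat.≟ ℓ ⌋) ∨ not (Wf 6 ℓ C) ≡ true
    avoided C rewrite small C with subsetᵇ C B in C⊆B | card C Nat.≟ ℓ
    ... | false | _ = refl
    ... | true | no _ = refl
    ... | true | yes |C|≡ℓ
      rewrite ⌊⌋-no (sumSub C Fin.≟ 1#) (no-1 C C⊆B |C|≡ℓ ∘ trans (sym (sumSub≡∑ C))) with subXᵇ C
    ...   | true = refl
    ...   | false = refl

  data ForbiddenSize : ℕ → Set where
    two   : ForbiddenSize 2
    three : ForbiddenSize 3
    four  : ForbiddenSize 4

  forbidden≢0 : ∀ {c} → ForbiddenSize c → c ≢ 0
  forbidden≢0 two ()
  forbidden≢0 three ()
  forbidden≢0 four ()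

  forbidden≤4 : ∀ {c} → ForbiddenSize c → c ≤ 4
  forbidden≤4 two = s≤s (s≤s z≤n)
  forbidden≤4 three = s≤s (s≤s (s≤s z≤n))
  forbidden≤4 four = ≤-refl

  record Block7 (B : Subset q) : Set where
    field
      ⊆X     : ∀ i → lookup B i ≡ true → InX i
      size   : card B ≡ 7
      sum≡1  : ∑ B ≡ 1#
      avoids : ∀ C → subsetᵇ C B ≡ true → ForbiddenSize (card C) → ∑ C ≢ 1#

  W7-sound : ∀ B → W 7 B ≡ true → Block7 B
  W7-sound B w with ∧-true {subXᵇ B} (trans (sym (W7-unfold B)) w)
  ... | B⊆X , w₁ with ∧-true {⌊ card B Nat.≟ 7 ⌋} w₁
  ... | |B|≡7 , w₂ with ∧-true {eqᵇ (sumSub B) 1#} w₂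
  ... | ∑B≡1 , w₃ with ∧-true {avoidsᵇ 2 B} w₃
  ... | a₂ , w₄ with ∧-true {avoidsᵇ 3 B} w₄
  ... | a₃ , w₅ = record
    { ⊆X = subXᵇ-sound B B⊆X
    ; size = ⌊⌋-true (card B Nat.≟ 7) |B|≡7
    ; sum≡1 = trans (sym (sumSub≡∑ B)) (⌊⌋-true (sumSub B Fin.≟ 1#) ∑B≡1)
    ; avoids = λ C C⊆B → avoids C C⊆B refl
    }
    where
    avoids : ∀ C → subsetᵇ C B ≡ true → ∀ {c} → card C ≡ c → ForbiddenSize c → ∑ C ≢ 1#
    avoids C C⊆B |C| two = avoidsᵇ-sound 2 small-2 B B⊆X a₂ C C⊆B |C|
    avoids C C⊆B |C| three = avoidsᵇ-sound 3 small-3 B B⊆X a₃ C C⊆B |C|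
    avoids C C⊆B |C| four = avoidsᵇ-sound 4 small-4 B B⊆X (proj₁ (∧-true w₅)) C C⊆B |C|

  W7-complete : ∀ B → Block7 B → W 7 B ≡ true
  W7-complete B b = trans (W7-unfold B)
    (∧-intro (subXᵇ-complete B ⊆X) (∧-intro (⌊⌋-yes (card B Nat.≟ 7) size)
      (∧-intro (⌊⌋-yes (sumSub B Fin.≟ 1#) (trans (sumSub≡∑ B) sum≡1))
      (∧-intro (avoidsᵇ-complete 2 small-2 B (avoiding two))
      (∧-intro (avoidsᵇ-complete 3 small-3 B (avoiding three))
      (∧-intro (avoidsᵇ-complete 4 small-4 B (avoiding four)) refl))))))
    where
    open Block7 b
    avoiding : ∀ {ℓ} → ForbiddenSize ℓ → ∀ C → subsetᵇ C B ≡ true → card C ≡ ℓ → ∑ C ≢ 1#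
    avoiding s C C⊆B |C|≡ℓ = avoids C C⊆B (subst ForbiddenSize (sym |C|≡ℓ) s)

  module BlockSubsets {B : Subset q} (b : Block7 B) where
    open Block7 b

    -- Sizes 1 and 2: elements lie in X, two distinct elements never sum to 0,
    -- and pairs summing to 1 are forbidden.
    tiny-sums : ∀ C → subsetᵇ C B ≡ true → card C ≡ 1 ⊎ card C ≡ 2 → InX (∑ C)
    tiny-sums C C⊆B (inj₁ |C|≡1) with ∑-card1 C |C|≡1
    ... | i , i∈C , ∑C≡i = subst InX (sym ∑C≡i) (⊆X i (⊆-∈ C B i C⊆B i∈C))
    tiny-sums C C⊆B (inj₂ |C|≡2) (inj₁ ∑C≡0) = ∑-card2 C |C|≡2 ∑C≡0
    tiny-sums C C⊆B (inj₂ |C|≡2) (inj₂ ∑C≡1) = avoids C C⊆B (subst ForbiddenSize (sym |C|≡2) two) ∑C≡1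

    -- The complement B △ C has 7 - |C| elements and sum 1 ⊕ ∑ C, so its sum is
    -- in {0, 1} exactly when that of C is.
    complement-size : ∀ C → subsetᵇ C B ≡ true → card (B △ C) + card C ≡ 7
    complement-size C C⊆B = trans (card-△ B C C⊆B) size

    complement-sum : ∀ C → ∑ (B △ C) ≡ 1# ⊕ ∑ C
    complement-sum C = trans (sumOver-△ id B C) (cong (_⊕ ∑ C) sum≡1)

    complement-sum01 : ∀ C → (∑ C ≡ 0# ⊎ ∑ C ≡ 1#) → (∑ (B △ C) ≡ 0# ⊎ ∑ (B △ C) ≡ 1#)
    complement-sum01 C (inj₁ ∑C≡0) = inj₂ (trans (complement-sum C) (trans (cong (1# ⊕_) ∑C≡0) (⊕-identityʳ 1#)))
    complement-sum01 C (inj₂ ∑C≡1) = inj₁ (trans (complement-sum C) (trans (cong (1# ⊕_) ∑C≡1) (x⊕x≡0 1#)))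

    complement-⊆ : ∀ C → subsetᵇ C B ≡ true → subsetᵇ (B △ C) B ≡ true
    complement-⊆ C C⊆B = △-⊆ B C B (⊆-refl B) C⊆B

    -- Sizes 3 and 4: if ∑ C = 1 then C is forbidden; if ∑ C = 0 then its
    -- complement (of size 4 or 3) sums to 1 and is forbidden.
    middle-sums : ∀ C → subsetᵇ C B ≡ true → ForbiddenSize (card C) → ForbiddenSize (card (B △ C)) → InX (∑ C)
    middle-sums C C⊆B sC sE (inj₂ ∑C≡1) = avoids C C⊆B sC ∑C≡1
    middle-sums C C⊆B sC sE (inj₁ ∑C≡0) with complement-sum01 C (inj₁ ∑C≡0)
    ... | inj₂ ∑E≡1 = avoids (B △ C) (complement-⊆ C C⊆B) sE ∑E≡1
    ... | inj₁ ∑E≡0 = 0≢1 (trans (sym ∑E≡0) (trans (complement-sum C) (trans (cong (1# ⊕_) ∑C≡0) (⊕-identityʳ 1#))))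

    proper-sums : ∀ C → subsetᵇ C B ≡ true → 1 ≤ card C → card C ≤ 6 → InX (∑ C)
    proper-sums C C⊆B 1≤|C| |C|≤6 with card C in |C| | complement-size C C⊆B
    proper-sums C C⊆B () _ | 0 | _
    ... | 1 | _ = tiny-sums C C⊆B (inj₁ |C|)
    ... | 2 | _ = tiny-sums C C⊆B (inj₂ |C|)
    ... | 3 | |E|+3≡7 = middle-sums C C⊆B (subst ForbiddenSize (sym |C|) three)
                          (subst ForbiddenSize (sym (+-cancelʳ-≡ 3 _ 4 |E|+3≡7)) four)
    ... | 4 | |E|+4≡7 = middle-sums C C⊆B (subst ForbiddenSize (sym |C|) four)
                          (subst ForbiddenSize (sym (+-cancelʳ-≡ 4 _ 3 |E|+4≡7)) three)
    ... | 5 | |E|+5≡7 = λ sum01 → tiny-sums (B △ C) (complement-⊆ C C⊆B) (inj₂ (+-cancelʳ-≡ 5 _ 2 |E|+5≡7)) (complement-sum01 C sum01)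
    ... | 6 | |E|+6≡7 = λ sum01 → tiny-sums (B △ C) (complement-⊆ C C⊆B) (inj₁ (+-cancelʳ-≡ 6 _ 1 |E|+6≡7)) (complement-sum01 C sum01)
    proper-sums C C⊆B _ (s≤s (s≤s (s≤s (s≤s (s≤s (s≤s ())))))) | suc (suc (suc (suc (suc (suc (suc _)))))) | _

  block-removal : ∀ D y → lookup D y ≡ false → Block7 (D [ y ]≔ true) →
    card D ≡ 6 × Independent D × ∑ D ⊕ 1# ≡ y
  block-removal D y y∉D b = |D|≡6 , independent , ∑D⊕1≡y
    where
    open Block7 b
    open BlockSubsets b
    |D|≡6 : card D ≡ 6
    |D|≡6 = suc-injective (trans (sym (card-insert D y y∉D)) size)
    independent : Independent D
    independent C C⊆D sum01 with card C in |C|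
    ... | zero = refl
    ... | suc c = ⊥-elim (proper-sums C (⊆-insert C D y C⊆D) (subst (1 ≤_) (sym |C|) (s≤s z≤n))
                    (≤-trans (card-mono C D C⊆D) (≤-reflexive |D|≡6)) sum01)
    ∑D⊕1≡y : ∑ D ⊕ 1# ≡ y
    ∑D⊕1≡y = sym (⊕-solveˡ (trans (sym (sumOver-insert id D y y∉D)) sum≡1))

  module Completion (D : Subset q) (y : Fin q) (y∉D : lookup D y ≡ false) (|D|≡6 : card D ≡ 6)
                    (ind : Independent D) (∑D⊕1≡y : ∑ D ⊕ 1# ≡ y) where
    B = D [ y ]≔ true

    D≢∅ : card D ≢ 0
    D≢∅ |D|≡0 with trans (sym |D|≡6) |D|≡0
    ... | ()

    -- y ∉ {0, 1} because ∑ D ∉ {0, 1}; the points of D are independent singletons.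
    completion-⊆X : ∀ i → lookup B i ≡ true → InX i
    completion-⊆X i i∈B with i Fin.≟ y
    ... | yes refl = λ
      { (inj₁ y≡0) → D≢∅ (ind D (⊆-refl D) (inj₂ (⊕≡0⇒≡ (trans ∑D⊕1≡y y≡0))))
      ; (inj₂ y≡1) → D≢∅ (ind D (⊆-refl D) (inj₁ (trans (⊕-solveˡ (trans ∑D⊕1≡y y≡1)) (x⊕x≡0 1#))))
      }
    ... | no i≢y = λ i∈01 → ⁅i⁆≢∅ (ind ⁅ i ⁆ (trans (⁅⁆-⊆ D i) i∈D)
                                  (subst (λ a → a ≡ 0# ⊎ a ≡ 1#) (sym (sumOver-⁅⁆ id i)) i∈01))
      where
      i∈D : lookup D i ≡ true
      i∈D = trans (sym (lookup∘update′ i≢y D true)) i∈B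
      ⁅i⁆≢∅ : card ⁅ i ⁆ ≢ 0
      ⁅i⁆≢∅ e with trans (sym (card-⁅⁆ i)) e
      ... | ()

    completion-sum : ∑ B ≡ 1#
    completion-sum = begin
      ∑ B                  ≡⟨ sumOver-insert id D y y∉D ⟩
      y ⊕ ∑ D              ≡⟨ cong (_⊕ ∑ D) ∑D⊕1≡y ⟨
      (∑ D ⊕ 1#) ⊕ ∑ D     ≡⟨ ⊕-comm (∑ D ⊕ 1#) (∑ D) ⟩
      ∑ D ⊕ (∑ D ⊕ 1#)     ≡⟨ ⊕-cancelˡ (∑ D) 1# ⟩
      1#                   ∎
      where open ≡-Reasoning

    -- A forbidden C ⊆ B with ∑ C = 1 cannot avoid y, as D is independent; if it
    -- contains y then C' = C \ {y} sums to ∑ D, so D △ C' ⊆ D sums to 0 while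
    -- having 6 − |C'| ≥ 3 elements.
    completion-avoids : ∀ C → subsetᵇ C B ≡ true → ForbiddenSize (card C) → ∑ C ≢ 1#
    completion-avoids C C⊆B sC ∑C≡1 with lookup C y in y∈C
    ... | false = forbidden≢0 sC (ind C (trans (sym (⊆-insert-∉ C D y y∈C)) C⊆B) (inj₂ ∑C≡1))
    ... | true = 6≰3 (subst (_≤ 3) |C'|≡6 |C'|≤3)
      where
      open ≡-Reasoning
      C' = C [ y ]≔ false
      E = D △ C'
      C'⊆D : subsetᵇ C' D ≡ true
      C'⊆D = ⊆-remove C D y C⊆B
      ∑C'≡∑D : ∑ C' ≡ ∑ D
      ∑C'≡∑D = begin
        ∑ C'            ≡⟨ ⊕-solveʳ (trans (sym (∑-remove C y y∈C)) ∑C≡1) ⟩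
        y ⊕ 1#          ≡⟨ cong (_⊕ 1#) ∑D⊕1≡y ⟨
        (∑ D ⊕ 1#) ⊕ 1# ≡⟨ ⊕-assoc (∑ D) 1# 1# ⟩
        ∑ D ⊕ (1# ⊕ 1#) ≡⟨ cong (∑ D ⊕_) (x⊕x≡0 1#) ⟩
        ∑ D ⊕ 0#        ≡⟨ ⊕-identityʳ (∑ D) ⟩
        ∑ D             ∎
      ∑E≡0 : ∑ E ≡ 0#
      ∑E≡0 = trans (sumOver-△ id D C') (trans (cong (∑ D ⊕_) ∑C'≡∑D) (x⊕x≡0 (∑ D)))
      |C'|≡6 : card C' ≡ 6
      |C'|≡6 = begin
        card C'          ≡⟨ cong (_+ card C') (ind E (△-⊆ D C' D (⊆-refl D) C'⊆D) (inj₁ ∑E≡0)) ⟨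
        card E + card C' ≡⟨ card-△ D C' C'⊆D ⟩
        card D           ≡⟨ |D|≡6 ⟩
        6                ∎
      |C'|≤3 : card C' ≤ 3
      |C'|≤3 = ≤-pred (subst (_≤ 4) (card-remove C y y∈C) (forbidden≤4 sC))
      6≰3 : ¬ (6 ≤ 3)
      6≰3 (s≤s (s≤s (s≤s ())))

    block-completion : Block7 B
    block-completion = record
      { ⊆X = completion-⊆X
      ; size = trans (card-insert D y y∉D) (cong suc |D|≡6)
      ; sum≡1 = completion-sum
      ; avoids = completion-avoids
      }

  -- For an independent D with at least two elements, ∑ D ⊕ 1 ∉ D: otherwise
  -- D \ {∑ D ⊕ 1} would be a nonempty subset summing to 1.
  completion-point-fresh : ∀ D → Independent D → 2 ≤ card D → lookup D (∑ D ⊕ 1#) ≡ false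
  completion-point-fresh D ind 2≤|D| with lookup D (∑ D ⊕ 1#) in y∈D
  ... | false = refl
  ... | true = ⊥-elim (<⇒≢ 1≤|C| (sym (ind C C⊆D (inj₂ ∑C≡1))))
    where
    y = ∑ D ⊕ 1#
    C = D [ y ]≔ false
    C⊆D : subsetᵇ C D ≡ true
    C⊆D = ⊆-remove D D y (⊆-insert D D y (⊆-refl D))
    ∑C≡1 : ∑ C ≡ 1#
    ∑C≡1 = trans (⊕-solveʳ (sym (∑-remove D y y∈D))) (trans (⊕-comm y (∑ D)) (⊕-cancelˡ (∑ D) 1#))
    1≤|C| : 1 ≤ card C
    1≤|C| = ≤-pred (subst (2 ≤_) (card-remove D y y∈D) 2≤|D|)

  W7-insert : ∀ D y → lookup D y ≡ false →
    W 7 (D [ y ]≔ true) ≡ (card D ≡ᵇ 6) ∧ (independentᵇ D ∧ ⌊ ∑ D ⊕ 1# Fin.≟ y ⌋)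
  W7-insert D y y∉D = ⇔→≡ {z = true} (mk⇔ removal completion)
    where
    removal : W 7 (D [ y ]≔ true) ≡ true → (card D ≡ᵇ 6) ∧ (independentᵇ D ∧ ⌊ ∑ D ⊕ 1# Fin.≟ y ⌋) ≡ true
    removal w with block-removal D y y∉D (W7-sound _ w)
    ... | |D|≡6 , ind , ∑D⊕1≡y =
      ∧-intro (≡ᵇ-complete |D|≡6) (∧-intro (independentᵇ-complete D ind) (⌊⌋-yes (∑ D ⊕ 1# Fin.≟ y) ∑D⊕1≡y))
    completion : (card D ≡ᵇ 6) ∧ (independentᵇ D ∧ ⌊ ∑ D ⊕ 1# Fin.≟ y ⌋) ≡ true → W 7 (D [ y ]≔ true) ≡ true
    completion e with ∧-true {card D ≡ᵇ 6} e
    ... | |D|≡6 , e′ with ∧-true {independentᵇ D} e′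
    ... | ind , ∑D⊕1≡y = W7-complete _ (Completion.block-completion D y y∉D (≡ᵇ-sound _ 6 |D|≡6)
                            (independentᵇ-sound D ind) (⌊⌋-true (∑ D ⊕ 1# Fin.≟ y) ∑D⊕1≡y))

  block-point-removal : ∀ A B y →
    ⟦ subsetᵇ A B ∧ (not (lookup B y) ∧ (subsetᵇ A (B [ y ]≔ true) ∧ W 7 (B [ y ]≔ true))) ⟧
      ≡ ⟦ independentSupersetᵇ A 6 B ⟧ * ⟦ ⌊ ∑ B ⊕ 1# Fin.≟ y ⌋ ⟧
  block-point-removal A B y with lookup B y in y∈B
  ... | false rewrite W7-insert B y y∈B with subsetᵇ A B in A⊆B
  ...   | false = refl
  ...   | true rewrite ⊆-insert A B y A⊆B = trans
          (cong ⟦_⟧ (sym (∧-assoc (card B ≡ᵇ 6) (independentᵇ B) ⌊ ∑ B ⊕ 1# Fin.≟ y ⌋)))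
          (⟦∧⟧ ((card B ≡ᵇ 6) ∧ independentᵇ B) ⌊ ∑ B ⊕ 1# Fin.≟ y ⌋)
  block-point-removal A B y | true with ⌊ ∑ B ⊕ 1# Fin.≟ y ⌋ in y≡∑B⊕1 | independentSupersetᵇ A 6 B in PB
  ... | false | P = trans (cong ⟦_⟧ (∧-zeroʳ (subsetᵇ A B))) (sym (*-zeroʳ ⟦ P ⟧))
  ... | true | false = cong ⟦_⟧ (∧-zeroʳ (subsetᵇ A B))
  ... | true | true with ∧-true {subsetᵇ A B} PB
  ...   | _ , PB′ with ∧-true {card B ≡ᵇ 6} PB′
  ...     | |B|≡6 , indB = ⊥-elim (true≢false (begin
    true                   ≡⟨ y∈B ⟨
    lookup B y             ≡⟨ cong (lookup B) (⌊⌋-true (∑ B ⊕ 1# Fin.≟ y) y≡∑B⊕1) ⟨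
    lookup B (∑ B ⊕ 1#)    ≡⟨ completion-point-fresh B (independentᵇ-sound B indB)
                                (subst (2 ≤_) (sym (≡ᵇ-sound _ 6 |B|≡6)) (s≤s (s≤s z≤n))) ⟩
    false                  ∎))
    where
    open ≡-Reasoning
    true≢false : true ≢ false
    true≢false ()

  -- Counting pairs (B, y), B ∈ W_7 with A ⊆ B and y ∈ B \ A, in two ways.
  blocks-containing : ∀ A → sumˢ (λ B → ⟦ subsetᵇ A B ∧ W 7 B ⟧) * (7 ∸ card A) ≡ independentSupersets A 6
  blocks-containing A = begin
    sumˢ (λ B → ⟦ R B ⟧) * (7 ∸ card A)           ≡⟨ sumˢ-distribʳ (λ B → ⟦ R B ⟧) (7 ∸ card A) ⟨
    sumˢ (λ B → ⟦ R B ⟧ * (7 ∸ card A))           ≡⟨ sumˢ-cong size ⟨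
    sumˢ (λ B → ⟦ R B ⟧ * (card B ∸ card A))      ≡⟨ double-count A R (λ B → proj₁ ∘ ∧-true) ⟩
    sum (λ y → sumˢ (λ B → ⟦ subsetᵇ A B ∧ (not (lookup B y) ∧ R (B [ y ]≔ true)) ⟧))
      ≡⟨ sum-cong-≗ (λ y → sumˢ-cong (λ B → block-point-removal A B y)) ⟩
    sum (λ y → sumˢ (λ B → ⟦ P B ⟧ * completes B y)) ≡⟨ sumˢ-comm (λ B y → ⟦ P B ⟧ * completes B y) ⟨
    sumˢ (λ B → sum (λ y → ⟦ P B ⟧ * completes B y)) ≡⟨ sumˢ-cong (λ B → *-distribˡ-sum ⟦ P B ⟧ (completes B)) ⟨
    sumˢ (λ B → ⟦ P B ⟧ * sum (completes B))         ≡⟨ sumˢ-cong (λ B → cong (⟦ P B ⟧ *_) (sum-≟ (∑ B ⊕ 1#))) ⟩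
    sumˢ (λ B → ⟦ P B ⟧ * 1)                         ≡⟨ sumˢ-cong (λ B → *-identityʳ ⟦ P B ⟧) ⟩
    independentSupersets A 6                         ∎
    where
    open ≡-Reasoning
    R : Subset q → Bool
    R B = subsetᵇ A B ∧ W 7 B
    P = independentSupersetᵇ A 6
    completes : Subset q → Fin q → ℕ
    completes B y = ⟦ ⌊ ∑ B ⊕ 1# Fin.≟ y ⌋ ⟧
    size : ∀ B → ⟦ R B ⟧ * (card B ∸ card A) ≡ ⟦ R B ⟧ * (7 ∸ card A)
    size B with R B in RB
    ... | false = refl
    ... | true = cong (λ c → 1 * (c ∸ card A)) (Block7.size (W7-sound B (proj₂ (∧-true {subsetᵇ A B} RB))))

  independentSupersets-formula : ∀ A {a} → card A ≡ a → ∀ j →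
    independentSupersets A (a + j) * j ! ≡ ⟦ independentᵇ A ⟧ * product j (λ i → q ∸ 2 ^ suc (a + i))
  independentSupersets-formula A {a} refl j = begin
    independentSupersets A (a + j) * j !
      ≡⟨ telescope (independentSupersets A) (λ k → q ∸ 2 ^ suc k) a step j ⟩
    independentSupersets A a * product j (λ i → q ∸ 2 ^ suc (a + i))
      ≡⟨ cong (_* product j (λ i → q ∸ 2 ^ suc (a + i))) (count-supersets-same-size A independentᵇ) ⟩
    ⟦ independentᵇ A ⟧ * product j (λ i → q ∸ 2 ^ suc (a + i)) ∎
    where
    open ≡-Reasoning
    step : ∀ j → independentSupersets A (suc (a + j)) * suc j ≡ independentSupersets A (a + j) * (q ∸ 2 ^ suc (a + j))
    step j = trans (cong (independentSupersets A (suc (a + j)) *_) (sym (trans (cong (_∸ a) (sym (+-suc a j))) (m+n∸m≡n a (suc j)))))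
                   (independentSupersets-step A (a + j))

  independent-∅ : independentᵇ ∅ ≡ true
  independent-∅ = independentᵇ-complete ∅ (λ C C⊆∅ _ → n≤0⇒n≡0 (subst (card C ≤_) (card-∅ q) (card-mono C ∅ C⊆∅)))

  -- A point of X is an independent singleton: its only nonempty subset sums to it.
  independent-⁅⁆ : ∀ x → InX x → independentᵇ ⁅ x ⁆ ≡ true
  independent-⁅⁆ x x∈X = independentᵇ-complete ⁅ x ⁆ independent
    where
    independent : Independent ⁅ x ⁆
    independent C C⊆x sum01 with card C in |C| | card-mono C ⁅ x ⁆ C⊆x
    ... | zero | _ = refl
    ... | suc zero | _ with ∑-card1 C |C|
    ...   | i , i∈C , ∑C≡i = ⊥-elim (x∈X (subst (λ a → a ≡ 0# ⊎ a ≡ 1#)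
              (trans ∑C≡i (⁅⁆-member x i (⊆-∈ C ⁅ x ⁆ i C⊆x i∈C))) sum01))
    independent C C⊆x sum01 | suc (suc _) | |C|≤1 with subst (suc (suc _) ≤_) (card-⁅⁆ x) |C|≤1
    ... | s≤s ()

  W7-size : sizeW 7 * 7 ≡ independentSupersets ∅ 6
  W7-size = begin
    sizeW 7 * 7                                ≡⟨ cong (_* 7) (count≡sumˢ q (W 7)) ⟩
    sumˢ (λ B → ⟦ W 7 B ⟧) * 7                 ≡⟨ cong (_* 7) (sumˢ-cong (λ B → cong (λ b → ⟦ b ∧ W 7 B ⟧) (∅-⊆ B))) ⟨
    sumˢ (λ B → ⟦ subsetᵇ ∅ B ∧ W 7 B ⟧) * 7   ≡⟨ cong (λ a → sumˢ (λ B → ⟦ subsetᵇ ∅ B ∧ W 7 B ⟧) * (7 ∸ a)) (card-∅ q) ⟨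
    sumˢ (λ B → ⟦ subsetᵇ ∅ B ∧ W 7 B ⟧) * (7 ∸ card {q} ∅) ≡⟨ blocks-containing ∅ ⟩
    independentSupersets ∅ 6                   ∎
    where open ≡-Reasoning

  W7-replication : ∀ x → repW 7 x * 6 ≡ independentSupersets ⁅ x ⁆ 6
  W7-replication x = begin
    repW 7 x * 6                                   ≡⟨ cong (_* 6) (count≡sumˢ q (λ B → W 7 B ∧ lookup B x)) ⟩
    sumˢ (λ B → ⟦ W 7 B ∧ lookup B x ⟧) * 6        ≡⟨ cong (_* 6) (sumˢ-cong containing) ⟩
    sumˢ (λ B → ⟦ subsetᵇ ⁅ x ⁆ B ∧ W 7 B ⟧) * 6   ≡⟨ cong (λ a → sumˢ (λ B → ⟦ subsetᵇ ⁅ x ⁆ B ∧ W 7 B ⟧) * (7 ∸ a)) (card-⁅⁆ x) ⟨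
    sumˢ (λ B → ⟦ subsetᵇ ⁅ x ⁆ B ∧ W 7 B ⟧) * (7 ∸ card ⁅ x ⁆) ≡⟨ blocks-containing ⁅ x ⁆ ⟩
    independentSupersets ⁅ x ⁆ 6                   ∎
    where
    open ≡-Reasoning
    containing : ∀ B → ⟦ W 7 B ∧ lookup B x ⟧ ≡ ⟦ subsetᵇ ⁅ x ⁆ B ∧ W 7 B ⟧
    containing B = cong ⟦_⟧ (trans (∧-comm (W 7 B) (lookup B x)) (cong (_∧ W 7 B) (sym (⁅⁆-⊆ B x))))

  W7-size-formula : sizeW 7 * 7 ! ≡ product 6 (λ i → q ∸ 2 ^ suc i)
  W7-size-formula = begin
    sizeW 7 * (7 * 6 !)                   ≡⟨ *-assoc (sizeW 7) 7 (6 !) ⟨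
    sizeW 7 * 7 * 6 !                     ≡⟨ cong (_* 6 !) W7-size ⟩
    independentSupersets ∅ (0 + 6) * 6 !  ≡⟨ independentSupersets-formula ∅ (card-∅ q) 6 ⟩
    ⟦ independentᵇ ∅ ⟧ * product 6 t      ≡⟨ cong (λ b → ⟦ b ⟧ * product 6 t) independent-∅ ⟩
    1 * product 6 t                       ≡⟨ *-identityˡ (product 6 t) ⟩
    product 6 t                           ∎
    where
    open ≡-Reasoning
    t = λ i → q ∸ 2 ^ suc i

  W7-replication-formula : ∀ x → InX x → repW 7 x * 6 ! ≡ product 5 (λ i → q ∸ 2 ^ suc (1 + i))
  W7-replication-formula x x∈X = begin
    repW 7 x * (6 * 5 !)                  ≡⟨ *-assoc (repW 7 x) 6 (5 !) ⟨
    repW 7 x * 6 * 5 !                    ≡⟨ cong (_* 5 !) (W7-replication x) ⟩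
    independentSupersets ⁅ x ⁆ (1 + 5) * 5 ! ≡⟨ independentSupersets-formula ⁅ x ⁆ (card-⁅⁆ x) 5 ⟩
    ⟦ independentᵇ ⁅ x ⁆ ⟧ * product 5 t  ≡⟨ cong (λ b → ⟦ b ⟧ * product 5 t) (independent-⁅⁆ x x∈X) ⟩
    1 * product 5 t                       ≡⟨ *-identityˡ (product 5 t) ⟩
    product 5 t                           ∎
    where
    open ≡-Reasoning
    t = λ i → q ∸ 2 ^ suc (1 + i)

-- Corollary 3.20 (r_7 and |W_7|).
corollary3p20 : (m : ℕ) → 7 ≤ m → (F : FieldOn (2 ^ m)) →
    ((x : Fin (2 ^ m)) → Blocks.inXᵇ F x ≡ true →
      Blocks.repW F 7 x * 720
        ≡ (2 ^ m ∸ 4) * (2 ^ m ∸ 8) * (2 ^ m ∸ 16) * (2 ^ m ∸ 32) * (2 ^ m ∸ 64))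
    × (Blocks.sizeW F 7 * 5040
        ≡ (2 ^ m ∸ 2) * (2 ^ m ∸ 4) * (2 ^ m ∸ 8) * (2 ^ m ∸ 16) * (2 ^ m ∸ 32) * (2 ^ m ∸ 64))
corollary3p20 (suc m) _ F = (λ x x∈X → W7-replication-formula x (inXᵇ-sound x x∈X)) , W7-size-formula
  where open CharTwo F (even-order⇒char2 F (2 ^ m) refl)
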